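{- Let $A$ be a nonempty finite set and let $(\mathcal P,\mathcal S)$ be a scenario on $A$. Then $(\mathcal P,\mathcal S)$ has a tree decomposition if and only if the captain has a winning strategy in the monotone captain and robber game on $(\mathcal P,\mathcal S)$.
   Context: A partition of $A$ is a set $P$ of pairwise disjoint subsets of $A$ (empty sets allowed) whose union is $A$; $\textup{Part}(A)$ denotes the set of all partitions of $A$. A partition $P_1$ is coarser than $P_2$ if every set in $P_1$ is a union of sets of $P_2$. The common coarsening $P_1\vee P_2$ is the partition of $A$ into the sets that are unions of sets of $P_1$ and also unions of sets of $P_2$, i.e. the finest common coarsening. For $X\subseteq A$, $X^c=A\setminus X$. A scenario on $A$ is a pair $(\mathcal P,\mathcal S)$ with $\mathcal P\subseteq\textup{Part}(A)$ and $\mathcal S\subseteq 2^A$ such that: (SC1) $\mathcal P$ is closed under taking coarser partitions; (SC2) if $X\subseteq S$ for some $S\in\mathcal S$ and $X\in P$ for some $P\in\mathcal P$, then $X\in\mathcal S$; (SC3) every $S\in\mathcal S$ satisfies $\{S,S^c\}\in\mathcal P$. Captain and robber game on $(\mathcal P,\mathcal S)$: initially the captain chooses $\{A\}$ and the robber chooses an element of $A$; if $\{A\}\notin\mathcal P$ the robber wins. In a position $(P,r)$ with $P\in\mathcal P$, $r\in X\in P$ ($X$ is the robber space), the captain announces a new partition $P'\in\mathcal P$; the robber then moves to any element $r'$ of the set $Y\in P\vee P'$ containing $X$; the new robber space is the set $X'\in P'$ with $r'\in X'$. If $X'\in\mathcal S$ the captain wins; otherwise play continues. The robber wins if he is never captured.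 In the monotone captain and robber game the captain, in position $(P,r)$ with robber space $X$, may only choose partitions $P'\in\mathcal P$ such that $X$ is a union of sets of $P'$. A tree is a nonempty connected acyclic graph; $L(T)$ is the set of nodes of degree at most one (leaves); other nodes are internal. A tree decomposition of $(\mathcal P,\mathcal S)$ is a pair $(T,\tau)$ where $T$ is a tree and $\tau:L(T)\to\mathcal S$ such that (TD1) the set $\tau(L(T))$ is a partition of $A$, and (TD2) for every internal node $t$, the partition $P_t:=\{\bigcup\tau(L(T)\cap V(T'))\mid T'\text{ a connected component of }T-t\}$ belongs to $\mathcal P$. -}

module Defs where

open import Data.Nat using (ℕ; suc; _≤_; _<_)
open import Data.Bool using (Bool; true; false; _∨_)
import Data.Bool as B
open import Data.Fin using (Fin)
open import Data.Fin.Subset using (Subset; _∈_; _⊆_; ∁; ⊤; ∣_∣)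
open import Data.Vec using (tabulate)
open import Data.Vec.Properties using (≡-dec)
open import Data.List using (List; []; _∷_; length; _∷ʳ_)
open import Data.List.Relation.Unary.Linked using (Linked)
open import Data.List.Relation.Unary.Unique.Propositional using (Unique)
open import Data.Product using (Σ; ∃; ∃-syntax; _×_)
open import Data.Empty using (⊥)
import Data.Unit
open import Data.Sum using (_⊎_)
open import Relation.Nullary using (¬_; Dec)
open import Relation.Nullary.Decidable using (⌊_⌋)
open import Relation.Binary.PropositionalEquality using (_≡_; _≢_)
open import Function.Bundles using (_⇔_)

-- The ground set A is  Fin (suc n)  (a nonempty finite set).
-- Subsets of A are  Subset (suc n)  (= Vec Bool (suc n)).
-- A family (set) of subsets of A is a Boolean-valued predicate on subsets.

_≟ˢ_ : ∀ {n} (X Y : Subset n) → Dec (X ≡ Y)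
_≟ˢ_ = ≡-dec B._≟_

Family : ℕ → Set
Family n = Subset n → Bool

infix 4 _∈ᶠ_
_∈ᶠ_ : ∀ {n} → Subset n → Family n → Set
Z ∈ᶠ P = P Z ≡ true

Disjoint : ∀ {n} → Subset n → Subset n → Set
Disjoint Z W = ∀ x → x ∈ Z → x ∈ W → ⊥

-- a set of subsets (given by a membership predicate M) is a partition of A:
-- pairwise disjoint (distinct members) and its union is A.  Empty sets allowed.
IsPartitionPred : ∀ {n} → (Subset n → Set) → Set
IsPartitionPred {n} M =
  (∀ Z W → M Z → M W → Z ≢ W → Disjoint Z W) ×
  (∀ (x : Fin n) → ∃[ Z ] (M Z × x ∈ Z))

IsPartition : ∀ {n} → Family n → Set
IsPartition P = IsPartitionPred (λ Z → Z ∈ᶠ P)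

IsUnionOf : ∀ {n} → Family n → Subset n → Set
IsUnionOf P X = ∀ x → x ∈ X → ∃[ Z ] (Z ∈ᶠ P × x ∈ Z × Z ⊆ X)

Coarser : ∀ {n} → Family n → Family n → Set
Coarser P₁ P₂ = ∀ Z → Z ∈ᶠ P₁ → IsUnionOf P₂ Z

-- r' lies in the set of P ∨ Q that contains r
-- (the intersection of all sets containing r that are unions of sets of P
--  and also unions of sets of Q)
InJoinBlock : ∀ {n} → Family n → Family n → Fin n → Fin n → Set
InJoinBlock P Q r r' = ∀ Z → IsUnionOf P Z → IsUnionOf Q Z → r ∈ Z → r' ∈ Z

trivialFam : ∀ {n} → Family n
trivialFam Z = ⌊ Z ≟ˢ ⊤ ⌋

pairFam : ∀ {n} → Subset n → Family n
pairFam S Z = ⌊ Z ≟ˢ S ⌋ ∨ ⌊ Z ≟ˢ ∁ S ⌋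

record IsScenario {n} (𝒫 : Family n → Set) (𝒮 : Subset n → Set) : Set₁ where
  field
    partitions : ∀ P → 𝒫 P → IsPartition P
    SC1 : ∀ P Q → 𝒫 P → IsPartition Q → Coarser Q P → 𝒫 Q
    SC2 : ∀ S X P → 𝒮 S → X ⊆ S → 𝒫 P → X ∈ᶠ P → 𝒮 X
    SC3 : ∀ S → 𝒮 S → 𝒫 (pairFam S)

-- Monotone captain and robber game.
-- MonoWins 𝒫 𝒮 P r : in position (P , r) the captain can force a capture.

data MonoWins {n} (𝒫 : Family n → Set) (𝒮 : Subset n → Set)
              (P : Family n) (r : Fin n) : Set where
  move : (P' : Family n) → 𝒫 P' →
         -- monotonicity: the robber space X is a union of sets of P'
         (∀ X → X ∈ᶠ P → r ∈ X → IsUnionOf P' X) →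
         -- every robber move r' in the block of P ∨ P' containing X, with
         -- new robber space X' ∈ P', is a capture or again winning
         (∀ r' → InJoinBlock P P' r r' →
            ∀ X' → X' ∈ᶠ P' → r' ∈ X' → 𝒮 X' ⊎ MonoWins 𝒫 𝒮 P' r') →
         MonoWins 𝒫 𝒮 P r

CaptainWinsMonotone : ∀ {n} → (Family n → Set) → (Subset n → Set) → Set
CaptainWinsMonotone 𝒫 𝒮 = 𝒫 trivialFam × (∀ r → MonoWins 𝒫 𝒮 trivialFam r)

-- Trees: finite simple graphs on Fin m (adjacency E, symmetric, irreflexive)

module _ {m : ℕ} (E : Fin m → Fin m → Bool) where

  Adj : Fin m → Fin m → Set
  Adj u v = E u v ≡ true

  data Walk (ok : Fin m → Set) : Fin m → Fin m → Set where
    here : ∀ {u} → ok u → Walk ok u u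
    step : ∀ {u v w} → ok u → Adj u v → Walk ok v w → Walk ok u w

  Connected : Set
  Connected = ∀ u v → Walk (λ _ → Data.Unit.⊤) u v

  -- a cycle v , vs : distinct vertices, at least 3 of them,
  -- consecutive ones adjacent and the last adjacent to the first
  IsCycle : Fin m → List (Fin m) → Set
  IsCycle v vs = Unique (v ∷ vs) × 2 ≤ length vs × Linked Adj ((v ∷ vs) ∷ʳ v)

  Acyclic : Set
  Acyclic = ∀ v vs → ¬ IsCycle v vs

  degree : Fin m → ℕ
  degree u = ∣ tabulate (E u) ∣

  IsLeaf : Fin m → Set
  IsLeaf u = degree u ≤ 1

record Tree : Set where
  field
    m         : ℕ
    E         : Fin m → Fin m → Bool
    symmetric : ∀ u v → E u v ≡ E v u
    irreflex  : ∀ u → E u u ≡ false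
    nonempty  : 1 ≤ m
    connected : Connected E
    acyclic   : Acyclic E

-- Tree decompositions.  τ is given on all nodes; only its values on
-- leaves are used (this is the same as a map L(T) → 𝒮).

record TreeDecomposition {n} (𝒫 : Family n → Set) (𝒮 : Subset n → Set) : Set₁ where
  field
    T : Tree
  open Tree T
  field
    τ   : Fin m → Subset n
    τ𝒮  : ∀ l → IsLeaf E l → 𝒮 (τ l)
    TD1 : IsPartitionPred (λ Z → ∃[ l ] (IsLeaf E l × τ l ≡ Z))
    -- (TD2) for internal t, P_t ∈ 𝒫, where the sets of P_t are, for each
    -- component of T - t (represented by any vertex u ≠ t in it), the union
    -- of τ over the leaves of T in that component
    TD2 : ∀ t → ¬ IsLeaf E t →
          ∃[ Pₜ ] ((∀ Z → (Z ∈ᶠ Pₜ) ⇔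
                     (∃[ u ] (u ≢ t ×
                       (∀ x → (x ∈ Z) ⇔
                         (∃[ l ] (IsLeaf E l × Walk E (λ w → w ≢ t) u l × x ∈ τ l))))))
                   × 𝒫 Pₜ)

module Submission where

-- (⇒) Given a tree decomposition (T, τ), the captain opens with Pₜ for an
-- internal node t (or with {τ l, τ lᶜ} if T has no internal node).  The robber
-- space is then the union of the bags on one side of t; the captain steps to
-- the neighbour t' of t on that side and announces Pₜ'.  This move is monotone,
-- a leaf t' captures the robber, and otherwise the set of nodes on the robber's
-- side strictly shrinks, so the robber is caught (DecompositionStrategy).
--
-- (⇐) A monotone winning strategy unfolds into a decomposition tree
-- (StrategyTree): an inductive tree whose nodes split their set into the blocks
-- of the captain's move and whose leaves are captures.  Its positions with the
-- parent relation form a tree (Positions), enumerated by Fin (Enumeration); the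
-- components of T - p are the subtrees of the children of p together with the
-- rest of the tree, so the partition at p is the split stored at p
-- (Decomposition).

open import Defs
open import Data.Nat using (ℕ; suc)
open import Data.Fin.Subset using (Subset)
open import Function.Bundles using (_⇔_)

open import Data.Nat using (zero; _+_; _≤_; _<_; z≤n; s≤s)
import Data.Nat.Properties as ℕP
open import Data.Bool using (Bool; true; false; _≟_)
open import Data.Bool.Properties using (T-≡; T-∨)
open import Data.Fin using (Fin; zero; suc; _↑ˡ_; _↑ʳ_; splitAt; join) renaming (_≤_ to _≤ᶠ_)
import Data.Fin.Properties as FinP
open import Data.Fin.Properties using (any?; all?)
open import Data.Fin.Subset using (_∈_; _∉_; _⊆_; _⊂_; ∁; ⊤; inside; outside; ∣_∣; _-_; ⁅_⁆) renaming (⊥ to ∅)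
open import Data.Fin.Subset.Properties
  using (_∈?_; ∈⊤; ∉⊥; ⊥⊆; x∈∁p⇒x∉p; x∉p⇒x∈∁p; ⊆-antisym; Empty-unique; ∣⊥∣≡0; ∣p∣≤n; p⊂q⇒∣p∣<∣q∣;
         x∈p⇒∣p-x∣<∣p∣; x∈p∧x≢y⇒x∈p-y; p─q⊆p)
open import Data.Vec using (tabulate; []; _∷_) renaming (here to vhere; there to vthere)
open import Data.Vec.Properties using (lookup∘tabulate; []=⇒lookup; lookup⇒[]=)
open import Data.List using (List; []; _∷_; length; _∷ʳ_; _++_; map)
open import Data.List.Properties using (length-map; map-++)
open import Data.List.Membership.Propositional using () renaming (_∈_ to _∈ₗ_)
open import Data.List.Relation.Unary.Any using (here; there)
open import Data.List.Relation.Unary.All using (All; []; _∷_)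
import Data.List.Relation.Unary.All as All
open import Data.List.Relation.Unary.All.Properties using (All¬⇒¬Any; ¬Any⇒All¬)
open import Data.List.Relation.Unary.AllPairs using ([]; _∷_)
open import Data.List.Relation.Unary.Linked using (Linked; [-]; _∷_)
import Data.List.Relation.Unary.Linked as Linked
import Data.List.Relation.Unary.Linked.Properties as Linkedₚ
open import Data.List.Relation.Unary.Unique.Propositional using (Unique)
import Data.List.Relation.Unary.Unique.Propositional.Properties as Uniqueₚ
open import Data.Product using (Σ; ∃-syntax; _×_; _,_; proj₁; proj₂)
open import Data.Sum using (_⊎_; inj₁; inj₂)
open import Data.Empty using (⊥; ⊥-elim)
open import Data.Unit using (tt) renaming (⊤ to Unit)
open import Function using (_∘_)
open import Function.Bundles using (mk⇔; Equivalence)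
open import Function.Properties.Equivalence using () renaming (trans to ⇔-trans; sym to ⇔-sym)
open import Relation.Nullary using (¬_; Dec; yes; no)
open import Relation.Nullary.Decidable
  using (⌊_⌋; _×-dec_; _⊎-dec_; _→-dec_; ¬?; toWitness; fromWitness; does-⇔; dec-false; isYes≗does)
open import Relation.Binary.PropositionalEquality using (_≡_; _≢_; refl; sym; trans; cong; subst; subst₂)

open Equivalence using (to; from)

does-true⇒ : ∀ {ℓ} {A : Set ℓ} (a? : Dec A) → ⌊ a? ⌋ ≡ true → A
does-true⇒ a? e = toWitness {a? = a?} (from T-≡ e)

⇒does-true : ∀ {ℓ} {A : Set ℓ} (a? : Dec A) → A → ⌊ a? ⌋ ≡ true
⇒does-true a? a = to T-≡ (fromWitness {a? = a?} a)

subsetOf : ∀ {k ℓ} {P : Fin k → Set ℓ} → (∀ x → Dec (P x)) → Subset k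
subsetOf P? = tabulate (λ x → ⌊ P? x ⌋)

∈tabulate⇔ : ∀ {k} (f : Fin k → Bool) {x} → x ∈ tabulate f ⇔ f x ≡ true
∈tabulate⇔ f {x} = mk⇔ (λ x∈ → trans (sym (lookup∘tabulate f x)) ([]=⇒lookup x∈))
                        (λ fx → lookup⇒[]= x (tabulate f) (trans (lookup∘tabulate f x) fx))

∈subsetOf⇔ : ∀ {k ℓ} {P : Fin k → Set ℓ} (P? : ∀ x → Dec (P x)) {x} → x ∈ subsetOf P? ⇔ P x
∈subsetOf⇔ P? {x} = mk⇔ (λ x∈ → does-true⇒ (P? x) (to (∈tabulate⇔ _) x∈))
                         (λ px → from (∈tabulate⇔ _) (⇒does-true (P? x) px))

∈trivialFam⇔ : ∀ {k} (Z : Subset k) → Z ∈ᶠ trivialFam ⇔ Z ≡ ⊤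
∈trivialFam⇔ Z = mk⇔ (does-true⇒ (Z ≟ˢ ⊤)) (⇒does-true (Z ≟ˢ ⊤))

∈pairFam⇔ : ∀ {k} (S Z : Subset k) → Z ∈ᶠ pairFam S ⇔ (Z ≡ S ⊎ Z ≡ ∁ S)
∈pairFam⇔ S Z = mk⇔ member⇒ ⇒member
  where
  member⇒ : Z ∈ᶠ pairFam S → Z ≡ S ⊎ Z ≡ ∁ S
  member⇒ e with to (T-∨ {⌊ Z ≟ˢ S ⌋}) (from T-≡ e)
  ... | inj₁ t = inj₁ (toWitness {a? = Z ≟ˢ S} t)
  ... | inj₂ t = inj₂ (toWitness {a? = Z ≟ˢ ∁ S} t)
  ⇒member : Z ≡ S ⊎ Z ≡ ∁ S → Z ∈ᶠ pairFam S
  ⇒member (inj₁ e) = to T-≡ (from (T-∨ {⌊ Z ≟ˢ S ⌋}) (inj₁ (fromWitness e)))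
  ⇒member (inj₂ e) = to T-≡ (from (T-∨ {⌊ Z ≟ˢ S ⌋}) (inj₂ (fromWitness e)))

block-unique : ∀ {k} {M : Subset k → Set} → IsPartitionPred M →
               ∀ {Z W x} → M Z → M W → x ∈ Z → x ∈ W → Z ≡ W
block-unique (disjoint , _) {Z} {W} {x} Z∈ W∈ x∈Z x∈W with Z ≟ˢ W
... | yes Z≡W = Z≡W
... | no Z≢W = ⊥-elim (disjoint Z W Z∈ W∈ Z≢W x x∈Z x∈W)

trivialFam-partition : ∀ {k} → IsPartition (trivialFam {k})
trivialFam-partition =
  (λ Z W Z∈ W∈ Z≢W → ⊥-elim (Z≢W (trans (to (∈trivialFam⇔ Z) Z∈) (sym (to (∈trivialFam⇔ W) W∈))))) ,
  (λ x → ⊤ , from (∈trivialFam⇔ ⊤) refl , ∈⊤)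

pairFam-partition : ∀ {k} (S : Subset k) → IsPartition (pairFam S)
pairFam-partition S = disjoint , cover
  where
  disjoint : ∀ Z W → Z ∈ᶠ pairFam S → W ∈ᶠ pairFam S → Z ≢ W → Disjoint Z W
  disjoint Z W Z∈ W∈ Z≢W x x∈Z x∈W with to (∈pairFam⇔ S Z) Z∈ | to (∈pairFam⇔ S W) W∈
  ... | inj₁ refl | inj₁ refl = Z≢W refl
  ... | inj₂ refl | inj₂ refl = Z≢W refl
  ... | inj₁ refl | inj₂ refl = x∈∁p⇒x∉p x∈W x∈Z
  ... | inj₂ refl | inj₁ refl = x∈∁p⇒x∉p x∈Z x∈W
  cover : ∀ x → ∃[ Z ] (Z ∈ᶠ pairFam S × x ∈ Z)
  cover x with x ∈? S
  ... | yes x∈S = S , from (∈pairFam⇔ S S) (inj₁ refl) , x∈S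
  ... | no x∉S = ∁ S , from (∈pairFam⇔ S (∁ S)) (inj₂ refl) , x∉p⇒x∈∁p x∉S

⊤-union : ∀ {k} {P : Family k} → IsPartition P → IsUnionOf P ⊤
⊤-union (_ , cover) x _ = let (Z , Z∈ , x∈Z) = cover x in Z , Z∈ , x∈Z , λ _ → ∈⊤

trivialFam-coarsest : ∀ {k} (P : Family k) → IsPartition P → Coarser trivialFam P
trivialFam-coarsest P P-part Z Z∈ = subst (IsUnionOf P) (sym (to (∈trivialFam⇔ Z) Z∈)) (⊤-union P-part)

trivialFam∈𝒫 : ∀ {k} {𝒫 : Family k → Set} {𝒮} → IsScenario 𝒫 𝒮 → ∀ S → 𝒮 S → 𝒫 trivialFam
trivialFam∈𝒫 sc S S∈ =
  IsScenario.SC1 sc (pairFam S) trivialFam (IsScenario.SC3 sc S S∈) trivialFam-partition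
    (trivialFam-coarsest (pairFam S) (pairFam-partition S))

subset-ext : ∀ {k} {Z W : Subset k} → (∀ x → x ∈ Z ⇔ x ∈ W) → Z ≡ W
subset-ext same = ⊆-antisym (λ {x} → to (same x)) (λ {x} → from (same x))

module Walks {m : ℕ} (E : Fin m → Fin m → Bool) where

  mapWalk : ∀ {ok ok' : Fin m → Set} → (∀ x → ok x → ok' x) → ∀ {u v} → Walk E ok u v → Walk E ok' u v
  mapWalk f (here o) = here (f _ o)
  mapWalk f (step o a w) = step (f _ o) a (mapWalk f w)

  infixr 5 _++ʷ_
  _++ʷ_ : ∀ {ok u v w} → Walk E ok u v → Walk E ok v w → Walk E ok u w
  here o ++ʷ w' = w'
  step o a w ++ʷ w' = step o a (w ++ʷ w')

  walkStart : ∀ {ok u v} → Walk E ok u v → ok u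
  walkStart (here o) = o
  walkStart (step o a w) = o

  walkEnd : ∀ {ok u v} → Walk E ok u v → ok v
  walkEnd (here o) = o
  walkEnd (step o a w) = walkEnd w

  -- Cutting a walk at its last visit of t: either it avoids t altogether,
  -- or its final part leaves t through a neighbour c and never returns.
  lastExit : ∀ {ok} (t : Fin m) {s a} → Walk E ok s a → a ≢ t →
             Walk E (λ x → ok x × x ≢ t) s a ⊎ ∃[ c ] (Adj E t c × Walk E (λ x → ok x × x ≢ t) c a)
  lastExit t (here o) a≢t = inj₁ (here (o , a≢t))
  lastExit t {s} (step {v = c} o s~c w) a≢t with lastExit t w a≢t
  ... | inj₂ exit = inj₂ exit
  ... | inj₁ w' with s FinP.≟ t
  ...   | yes refl = inj₂ (c , s~c , w')
  ...   | no s≢t = inj₁ (step (o , s≢t) s~c w')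

  exitFrom : ∀ {ok} (t : Fin m) {a} → Walk E ok t a → a ≢ t →
             ∃[ c ] (Adj E t c × Walk E (λ x → ok x × x ≢ t) c a)
  exitFrom t w a≢t with lastExit t w a≢t
  ... | inj₁ w' = ⊥-elim (proj₂ (walkStart w') refl)
  ... | inj₂ exit = exit

  entryInto : ∀ {ok} (t : Fin m) {a} → Walk E ok a t → a ≢ t →
              ∃[ b ] (Walk E (λ x → ok x × x ≢ t) a b × Adj E b t)
  entryInto t (here o) a≢t = ⊥-elim (a≢t refl)
  entryInto t {a} (step {v = c} o a~c w) a≢t with c FinP.≟ t
  ... | yes refl = a , here (o , a≢t) , a~c
  ... | no c≢t with entryInto t w c≢t
  ...   | b , w' , b~t = b , step (o , a≢t) a~c w' , b~t

  firstHit : ∀ {ok} (t : Fin m) {a b} → Walk E ok a b →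
             Walk E (λ x → ok x × x ≢ t) a b ⊎ Walk E ok a t
  firstHit t {a} (here o) with a FinP.≟ t
  ... | yes refl = inj₂ (here o)
  ... | no a≢t = inj₁ (here (o , a≢t))
  firstHit t {a} (step o a~c w) with a FinP.≟ t
  ... | yes refl = inj₂ (here o)
  ... | no a≢t with firstHit t w
  ...   | inj₁ w' = inj₁ (step (o , a≢t) a~c w')
  ...   | inj₂ w' = inj₂ (step o a~c w')

  module Undirected (symmetric : ∀ u v → E u v ≡ E v u) where

    adj-sym : ∀ {u v} → Adj E u v → Adj E v u
    adj-sym {u} {v} u~v = trans (sym (symmetric u v)) u~v

    reverseWalk : ∀ {ok u v} → Walk E ok u v → Walk E ok v u
    reverseWalk w = go w (here (walkStart w))
      where
      go : ∀ {ok u v x} → Walk E ok u v → Walk E ok u x → Walk E ok v x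
      go (here o) acc = acc
      go (step o a w) acc = go w (step (walkStart w) (adj-sym a) acc)

  -- Reachability through vertices satisfying a decidable predicate is decidable:
  -- search from u within a set K of admissible vertices, removing u from K before
  -- searching on from a neighbour, so that ∣ K ∣ bounds the search depth.
  private
    walkWithin? : (fuel : ℕ) (K : Subset m) → ∣ K ∣ < fuel → ∀ u v → Dec (Walk E (_∈ K) u v)
    walkWithin? zero K () u v
    walkWithin? (suc fuel) K size<fuel u v with u ∈? K
    ... | no u∉K = no (λ w → u∉K (walkStart w))
    ... | yes u∈K with u FinP.≟ v
    ...   | yes refl = yes (here u∈K)
    ...   | no u≢v with any? (λ c → (E u c ≟ true) ×-dec walkWithin? fuel (K - u) smaller c v)
      where
      smaller : ∣ K - u ∣ < fuel
      smaller = ℕP.<-≤-trans (x∈p⇒∣p-x∣<∣p∣ u∈K) (ℕP.≤-pred size<fuel)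
    ...     | yes (c , u~c , w) = yes (step u∈K u~c (mapWalk (λ x → p─q⊆p K ⁅ u ⁆) w))
    ...     | no ¬step = no λ w →
                let (c , u~c , w') = exitFrom u w (λ v≡u → u≢v (sym v≡u))
                in ¬step (c , u~c , mapWalk (λ x (x∈K , x≢u) → x∈p∧x≢y⇒x∈p-y x∈K x≢u) w')

  walk? : ∀ {ok : Fin m → Set} → (∀ x → Dec (ok x)) → ∀ u v → Dec (Walk E ok u v)
  walk? ok? u v with walkWithin? (suc m) (subsetOf ok?) (s≤s (∣p∣≤n (subsetOf ok?))) u v
  ... | yes w = yes (mapWalk (λ x → to (∈subsetOf⇔ ok?)) w)
  ... | no ¬w = no (λ w → ¬w (mapWalk (λ x → from (∈subsetOf⇔ ok?)) w))

∈⇒1≤∣p∣ : ∀ {k} {p : Subset k} {x} → x ∈ p → 1 ≤ ∣ p ∣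
∈⇒1≤∣p∣ {p = inside ∷ p} _ = s≤s z≤n
∈⇒1≤∣p∣ {p = outside ∷ p} (vthere x∈p) = ∈⇒1≤∣p∣ x∈p

∣p∣≤1⇔subsingleton : ∀ {k} (p : Subset k) → ∣ p ∣ ≤ 1 ⇔ (∀ {a b} → a ∈ p → b ∈ p → a ≡ b)
∣p∣≤1⇔subsingleton [] = mk⇔ (λ _ ()) (λ _ → z≤n)
∣p∣≤1⇔subsingleton (outside ∷ p) = mk⇔
  (λ { le (vthere a∈) (vthere b∈) → cong suc (to (∣p∣≤1⇔subsingleton p) le a∈ b∈) })
  (λ sub → from (∣p∣≤1⇔subsingleton p) (λ a∈ b∈ → FinP.suc-injective (sub (vthere a∈) (vthere b∈))))
∣p∣≤1⇔subsingleton {suc k} (inside ∷ p) = mk⇔ single (λ sub → s≤s (ℕP.≤-reflexive (rest-empty sub)))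
  where
  single : suc ∣ p ∣ ≤ 1 → ∀ {a b} → a ∈ inside ∷ p → b ∈ inside ∷ p → a ≡ b
  single _ vhere vhere = refl
  single (s≤s le) vhere (vthere b∈) = ⊥-elim (ℕP.<⇒≱ (∈⇒1≤∣p∣ b∈) le)
  single (s≤s le) (vthere a∈) _ = ⊥-elim (ℕP.<⇒≱ (∈⇒1≤∣p∣ a∈) le)
  rest-empty : (∀ {a b} → a ∈ inside ∷ p → b ∈ inside ∷ p → a ≡ b) → ∣ p ∣ ≡ 0
  rest-empty sub = trans (cong ∣_∣ (Empty-unique (λ (b , b∈) → FinP.0≢1+n (sub vhere (vthere b∈))))) (∣⊥∣≡0 k)

leaf⇔ : ∀ {m} (E : Fin m → Fin m → Bool) (u : Fin m) →
        IsLeaf E u ⇔ (∀ {a b} → Adj E u a → Adj E u b → a ≡ b)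
leaf⇔ E u = mk⇔
  (λ leaf {a} {b} u~a u~b → to (∣p∣≤1⇔subsingleton _) leaf (neighbour u~a) (neighbour u~b))
  (λ sub → from (∣p∣≤1⇔subsingleton _) (λ a∈ b∈ → sub (adjacent a∈) (adjacent b∈)))
  where
  neighbour : ∀ {a} → Adj E u a → a ∈ tabulate (E u)
  neighbour = from (∈tabulate⇔ (E u))
  adjacent : ∀ {a} → a ∈ tabulate (E u) → Adj E u a
  adjacent = to (∈tabulate⇔ (E u))

module Paths {m : ℕ} (E : Fin m → Fin m → Bool) where
  open import Data.List.Membership.DecPropositional (FinP._≟_ {m}) using () renaming (_∈?_ to _∈ₗ?_)

  vertices : ∀ {ok u v} → Walk E ok u v → List (Fin m)
  vertices (here {u} _) = u ∷ []
  vertices (step {u} _ _ w) = u ∷ vertices w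

  vertices-ok : ∀ {ok u v} (w : Walk E ok u v) → All ok (vertices w)
  vertices-ok (here o) = o ∷ []
  vertices-ok (step o _ w) = o ∷ vertices-ok w

  suffixFrom : ∀ {ok z y x} (w : Walk E ok z y) → x ∈ₗ vertices w →
               Σ (Walk E ok x y) (λ w' → ∃[ pre ] (vertices w ≡ pre ++ vertices w'))
  suffixFrom (here o) (here refl) = here o , [] , refl
  suffixFrom (step o a w) (here refl) = step o a w , [] , refl
  suffixFrom (step {z} o a w) (there x∈) with suffixFrom w x∈
  ... | w' , pre , eq = w' , z ∷ pre , cong (z ∷_) eq

  unique-suffix : ∀ (pre : List (Fin m)) {ys} → Unique (pre ++ ys) → Unique ys
  unique-suffix [] u = u
  unique-suffix (_ ∷ pre) (_ ∷ u) = unique-suffix pre u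

  toPath : ∀ {ok x y} → Walk E ok x y → Σ (Walk E ok x y) (λ w → Unique (vertices w))
  toPath (here o) = here o , [] ∷ []
  toPath (step {x} o a w) with toPath w
  ... | w₁ , u₁ with x ∈ₗ? vertices w₁
  ...   | yes x∈ = let (w' , pre , eq) = suffixFrom w₁ x∈ in w' , unique-suffix pre (subst Unique eq u₁)
  ...   | no x∉ = step o a w₁ , ¬Any⇒All¬ _ x∉ ∷ u₁

module TreeFacts (T : Tree) where
  open Tree T
  open Walks E
  open Undirected symmetric
  open Paths E

  adj⇒≢ : ∀ {u v} → Adj E u v → u ≢ v
  adj⇒≢ {u} u~u refl with trans (sym u~u) (irreflex u)
  ... | ()

  private
    linked : ∀ {ok s c b t} → Adj E s c → (w : Walk E ok c b) → Adj E b t →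
             Linked (Adj E) (s ∷ (vertices w ∷ʳ t))
    linked s~c (here o) b~t = s~c ∷ (b~t ∷ [-])
    linked s~c (step o a w) b~t = s~c ∷ linked a w b~t

    length≥1 : ∀ {ok c b} (w : Walk E ok c b) → 1 ≤ length (vertices w)
    length≥1 (here o) = s≤s z≤n
    length≥1 (step o a w) = s≤s z≤n

  -- For an edge t—t', no vertex a can be reached from t' avoiding t and
  -- reach t avoiding t': the two walks would close a cycle through the edge.
  no-return : ∀ {t t' a} → Adj E t t' →
              Walk E (_≢ t) t' a → Walk E (_≢ t') a t → ⊥
  no-return {t} {t'} t~t' from-t' to-t =
    acyclic t (t' ∷ vertices path)
      ( (adj⇒≢ t~t' ∷ All.map (λ (x≢t , _) t≡x → x≢t (sym t≡x)) path-ok)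
        ∷ (All.map (λ (_ , x≢t') t'≡x → x≢t' (sym t'≡x)) path-ok ∷ path-unique)
      , s≤s (length≥1 path)
      , t~t' ∷ linked t'~c path b~t )
    where
    exit = exitFrom t' from-t' (walkStart to-t)
    entry = entryInto t to-t (walkEnd from-t')
    c = proj₁ exit
    t'~c = proj₁ (proj₂ exit)
    b~t = proj₂ (proj₂ entry)
    detour : Walk E (λ x → x ≢ t × x ≢ t') c (proj₁ entry)
    detour = mapWalk (λ x (x≢t , x≢t') → x≢t , x≢t') (proj₂ (proj₂ exit))
          ++ʷ mapWalk (λ x (x≢t' , x≢t) → x≢t , x≢t') (proj₁ (proj₂ entry))
    path = proj₁ (toPath detour)
    path-unique = proj₂ (toPath detour)
    path-ok = vertices-ok path

  same-side : ∀ {t t' a b} → Adj E t t' → Walk E (_≢ t) t' a → Walk E (_≢ t') a b →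
              Walk E (_≢ t) t' b
  same-side {t} t~t' t'⋯a a⋯b with firstHit t a⋯b
  ... | inj₁ avoiding = t'⋯a ++ʷ mapWalk (λ x → proj₂) avoiding
  ... | inj₂ reaching = ⊥-elim (no-return t~t' t'⋯a reaching)

module DecompositionStrategy {n : ℕ} {𝒫 : Family (suc n) → Set} {𝒮 : Subset (suc n) → Set}
                             (sc : IsScenario 𝒫 𝒮) (td : TreeDecomposition 𝒫 𝒮) where
  open IsScenario sc
  open TreeDecomposition td
  open Tree T
  open Walks E
  open Undirected symmetric
  open TreeFacts T

  leaf? : ∀ l → Dec (IsLeaf E l)
  leaf? l = degree E l ℕP.≤? 1

  Side : Fin m → Fin m → Fin (suc n) → Set
  Side t u x = ∃[ l ] (IsLeaf E l × Walk E (_≢ t) u l × x ∈ τ l)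

  avoiding? : ∀ t u v → Dec (Walk E (_≢ t) u v)
  avoiding? t = walk? (λ w → ¬? (w FinP.≟ t))

  side? : ∀ t u x → Dec (Side t u x)
  side? t u x = any? (λ l → leaf? l ×-dec avoiding? t u l ×-dec x ∈? τ l)

  sideSet : Fin m → Fin m → Subset (suc n)
  sideSet t u = subsetOf (side? t u)

  ∈sideSet⇔ : ∀ t u {x} → x ∈ sideSet t u ⇔ Side t u x
  ∈sideSet⇔ t u = ∈subsetOf⇔ (side? t u)

  -- the vertices reachable from u in T - t; it measures the progress of the captain
  region : Fin m → Fin m → Subset m
  region t u = subsetOf (avoiding? t u)

  Pₜ : ∀ t → ¬ IsLeaf E t → Family (suc n)
  Pₜ t int = proj₁ (TD2 t int)

  ∈Pₜ⇔ : ∀ t int Z → Z ∈ᶠ Pₜ t int ⇔ (∃[ u ] (u ≢ t × (∀ x → x ∈ Z ⇔ Side t u x)))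
  ∈Pₜ⇔ t int = proj₁ (proj₂ (TD2 t int))

  Pₜ∈𝒫 : ∀ t int → 𝒫 (Pₜ t int)
  Pₜ∈𝒫 t int = proj₂ (proj₂ (TD2 t int))

  Pₜ-partition : ∀ t int → IsPartition (Pₜ t int)
  Pₜ-partition t int = partitions _ (Pₜ∈𝒫 t int)

  sideSet∈Pₜ : ∀ t int u → u ≢ t → sideSet t u ∈ᶠ Pₜ t int
  sideSet∈Pₜ t int u u≢t = from (∈Pₜ⇔ t int (sideSet t u)) (u , u≢t , λ x → ∈sideSet⇔ t u)

  towards : ∀ t u → u ≢ t → ∃[ t' ] (Adj E t t' × Walk E (_≢ t) t' u)
  towards t u u≢t with exitFrom t (connected t u) u≢t
  ... | t' , t~t' , w = t' , t~t' , mapWalk (λ _ → proj₂) w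

  leaf-side : ∀ {t t' u x} → Adj E t t' → IsLeaf E t' → Walk E (_≢ t) t' u → Side t u x ⇔ x ∈ τ t'
  leaf-side {t} {t'} t~t' t'-leaf t'⋯u = mk⇔
    (λ (l , _ , u⋯l , x∈) → subst (λ z → _ ∈ τ z) (only-t' (t'⋯u ++ʷ u⋯l)) x∈)
    (λ x∈ → t' , t'-leaf , reverseWalk t'⋯u , x∈)
    where
    only-t' : ∀ {v} → Walk E (_≢ t) t' v → v ≡ t'
    only-t' (here _) = refl
    only-t' (step _ t'~c w) = ⊥-elim (walkStart w (sym (to (leaf⇔ E t') t'-leaf (adj-sym t~t') t'~c)))

  nested : ∀ {t t' u l v} → Adj E t t' → Walk E (_≢ t) t' u → Walk E (_≢ t) u l →
           Walk E (_≢ t') l v → Walk E (_≢ t) u v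
  nested t~t' t'⋯u u⋯l l⋯v = reverseWalk t'⋯u ++ʷ same-side t~t' (t'⋯u ++ʷ u⋯l) l⋯v

  region-shrinks : ∀ {t t' u l} → Adj E t t' → Walk E (_≢ t) t' u → Walk E (_≢ t) u l →
                   region t' l ⊂ region t u
  region-shrinks {t} {t'} {u} {l} t~t' t'⋯u u⋯l =
    (λ v∈ → reach t u (nested t~t' t'⋯u u⋯l (unreach t' l v∈))) ,
    t' , reach t u (reverseWalk t'⋯u) , (λ t'∈ → walkEnd (unreach t' l t'∈) refl)
    where
    reach : ∀ t u {v} → Walk E (_≢ t) u v → v ∈ region t u
    reach t u = from (∈subsetOf⇔ (avoiding? t u))
    unreach : ∀ t u {v} → v ∈ region t u → Walk E (_≢ t) u v
    unreach t u = to (∈subsetOf⇔ (avoiding? t u))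

  bag⊆side : ∀ {t l x} → IsLeaf E l → l ≢ t → x ∈ τ l → x ∈ sideSet t l
  bag⊆side {t} {l} l-leaf l≢t x∈ = from (∈sideSet⇔ t l) (l , l-leaf , here l≢t , x∈)

  leaf≢internal : ∀ {l t} → IsLeaf E l → ¬ IsLeaf E t → l ≢ t
  leaf≢internal l-leaf t-int refl = t-int l-leaf

  block-is-side : ∀ t int {l X r} → IsLeaf E l → X ∈ᶠ Pₜ t int → r ∈ X → r ∈ τ l →
                  ∀ x → x ∈ X ⇔ Side t l x
  block-is-side t int {l} l-leaf X∈ r∈X r∈l x = subst (λ Z → x ∈ Z ⇔ Side t l x) (sym X≡side) (∈sideSet⇔ t l)
    where
    l≢t = leaf≢internal l-leaf int
    X≡side = block-unique (Pₜ-partition t int) X∈ (sideSet∈Pₜ t int l l≢t) r∈X (bag⊆side l-leaf l≢t r∈l)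

  side-union : ∀ {t t' u X} → Adj E t t' → Walk E (_≢ t) t' u → (t'-int : ¬ IsLeaf E t') →
               (∀ x → x ∈ X ⇔ Side t u x) → IsUnionOf (Pₜ t' t'-int) X
  side-union {t} {t'} {u} {X} t~t' t'⋯u t'-int X≈side x x∈ with to (X≈side x) x∈
  ... | l , l-leaf , u⋯l , x∈l =
    sideSet t' l , sideSet∈Pₜ t' t'-int l l≢t' , bag⊆side l-leaf l≢t' x∈l , side⊆X
    where
    l≢t' = leaf≢internal l-leaf t'-int
    side⊆X : sideSet t' l ⊆ X
    side⊆X y∈ with to (∈sideSet⇔ t' l) y∈
    ... | l' , l'-leaf , l⋯l' , y∈l' = from (X≈side _) (l' , l'-leaf , nested t~t' t'⋯u u⋯l l⋯l' , y∈l')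

  -- The captain's strategy at an internal node t when the robber space X is the
  -- side of u: step to the neighbour t' towards u.  A leaf t' captures the robber;
  -- otherwise Pₜ' is a monotone move and the robber ends up on the side of a leaf
  -- l in T - t', whose region is strictly smaller, so the fuel decreases.
  chase : ∀ fuel t (int : ¬ IsLeaf E t) u → u ≢ t → ∣ region t u ∣ < fuel →
          ∀ r X → X ∈ᶠ Pₜ t int → (∀ x → x ∈ X ⇔ Side t u x) → r ∈ X →
          𝒮 X ⊎ MonoWins 𝒫 𝒮 (Pₜ t int) r
  chase (suc fuel) t int u u≢t small r X X∈ X≈side r∈X with towards t u u≢t
  ... | t' , t~t' , t'⋯u with leaf? t'
  ...   | yes t'-leaf = inj₁ (subst 𝒮 (sym X≡bag) (τ𝒮 t' t'-leaf))
    where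
    X≡bag : X ≡ τ t'
    X≡bag = subset-ext λ x → ⇔-trans (X≈side x) (leaf-side t~t' t'-leaf t'⋯u)
  ...   | no t'-int = inj₂ (move (Pₜ t' t'-int) (Pₜ∈𝒫 t' t'-int) monotone respond)
    where
    X-union : IsUnionOf (Pₜ t' t'-int) X
    X-union = side-union t~t' t'⋯u t'-int X≈side

    monotone : ∀ X₀ → X₀ ∈ᶠ Pₜ t int → r ∈ X₀ → IsUnionOf (Pₜ t' t'-int) X₀
    monotone X₀ X₀∈ r∈X₀ = subst (IsUnionOf _) (block-unique (Pₜ-partition t int) X∈ X₀∈ r∈X r∈X₀) X-union

    -- the robber stays inside X, so his new space is the side of some leaf
    respond : ∀ r' → InJoinBlock (Pₜ t int) (Pₜ t' t'-int) r r' →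
              ∀ X' → X' ∈ᶠ Pₜ t' t'-int → r' ∈ X' → 𝒮 X' ⊎ MonoWins 𝒫 𝒮 (Pₜ t' t'-int) r'
    respond r' r⋯r' X' X'∈ r'∈X' with to (X≈side r') (r⋯r' X (λ x x∈ → X , X∈ , x∈ , λ y∈ → y∈) X-union r∈X)
    ... | l , l-leaf , u⋯l , r'∈l =
      chase fuel t' t'-int l (leaf≢internal l-leaf t'-int)
            (ℕP.<-≤-trans (p⊂q⇒∣p∣<∣q∣ (region-shrinks t~t' t'⋯u u⋯l)) (ℕP.≤-pred small))
            r' X' X'∈ (block-is-side t' t'-int l-leaf X'∈ r'∈X' r'∈l) r'∈X'

  win-from-block : ∀ t int r X → X ∈ᶠ Pₜ t int → r ∈ X → 𝒮 X ⊎ MonoWins 𝒫 𝒮 (Pₜ t int) r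
  win-from-block t int r X X∈ r∈X with to (∈Pₜ⇔ t int X) X∈
  ... | u , u≢t , X≈side = chase (suc m) t int u u≢t (s≤s (∣p∣≤n (region t u))) r X X∈ X≈side r∈X

  bag-cover : ∀ x → ∃[ l ] (IsLeaf E l × x ∈ τ l)
  bag-cover x with proj₂ TD1 x
  ... | _ , (l , l-leaf , refl) , x∈ = l , l-leaf , x∈

  bag-unique : ∀ {l l' x} → IsLeaf E l → IsLeaf E l' → x ∈ τ l → x ∈ τ l' → τ l ≡ τ l'
  bag-unique l-leaf l'-leaf = block-unique TD1 (_ , l-leaf , refl) (_ , l'-leaf , refl)

  -- A tree without internal nodes has at most two vertices, so the bags are
  -- τ l₀ and (if present) the complement of τ l₀.
  module NoInternalNode (all-leaves : ∀ t → IsLeaf E t) (l₀ : Fin m) where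

    -- walking from l₀ never gets further than a neighbour of l₀, which is a leaf
    near-l₀ : ∀ {s v} → (s ≡ l₀ ⊎ Adj E l₀ s) → Walk E (λ _ → Unit) s v → v ≡ l₀ ⊎ Adj E l₀ v
    near-l₀ s-near (here _) = s-near
    near-l₀ (inj₁ refl) (step _ l₀~c w) = near-l₀ (inj₂ l₀~c) w
    near-l₀ (inj₂ l₀~s) (step _ s~c w) =
      near-l₀ (inj₁ (sym (to (leaf⇔ E _) (all-leaves _) (adj-sym l₀~s) s~c))) w

    others-coincide : ∀ {a b} → a ≢ l₀ → b ≢ l₀ → a ≡ b
    others-coincide {a} {b} a≢l₀ b≢l₀ with near-l₀ (inj₁ refl) (connected l₀ a) | near-l₀ (inj₁ refl) (connected l₀ b)
    ... | inj₁ a≡l₀ | _ = ⊥-elim (a≢l₀ a≡l₀)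
    ... | _ | inj₁ b≡l₀ = ⊥-elim (b≢l₀ b≡l₀)
    ... | inj₂ l₀~a | inj₂ l₀~b = to (leaf⇔ E l₀) (all-leaves l₀) l₀~a l₀~b

    complement-bag : ∀ {l x} → IsLeaf E l → x ∈ τ l → x ∉ τ l₀ → ∁ (τ l₀) ≡ τ l
    complement-bag {l} {x} l-leaf x∈l x∉l₀ = ⊆-antisym ⊆bag bag⊆
      where
      l≢l₀ : l ≢ l₀
      l≢l₀ refl = x∉l₀ x∈l
      ⊆bag : ∁ (τ l₀) ⊆ τ l
      ⊆bag {y} y∈ with bag-cover y
      ... | l' , _ , y∈l' = subst (λ z → y ∈ τ z) (others-coincide (λ { refl → x∈∁p⇒x∉p y∈ y∈l' }) l≢l₀) y∈l'
      bag⊆ : τ l ⊆ ∁ (τ l₀)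
      bag⊆ {y} y∈l = x∉p⇒x∈∁p λ y∈l₀ →
        x∉l₀ (subst (x ∈_) (bag-unique l-leaf (all-leaves l₀) y∈l y∈l₀) x∈l)

  from-top : ∀ P → IsPartition P → ∀ r X → X ∈ᶠ trivialFam {suc n} → r ∈ X → IsUnionOf P X
  from-top P P-part r X X∈ _ = trivialFam-coarsest P P-part X X∈

  opening : ∀ {l} → IsLeaf E l → 𝒫 trivialFam
  opening {l} l-leaf = trivialFam∈𝒫 sc (τ l) (τ𝒮 l l-leaf)

  captain-wins : CaptainWinsMonotone 𝒫 𝒮
  captain-wins with bag-cover zero | any? (λ t → ¬? (leaf? t))
  ... | l₀ , l₀-leaf , _ | yes (t , int) =
    opening l₀-leaf , λ r → move (Pₜ t int) (Pₜ∈𝒫 t int) (from-top (Pₜ t int) (Pₜ-partition t int) r)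
                                  (λ r' _ → win-from-block t int r')
  ... | l₀ , l₀-leaf , _ | no no-internal =
    opening l₀-leaf , λ r → move (pairFam (τ l₀)) (SC3 (τ l₀) (τ𝒮 l₀ l₀-leaf))
                                  (from-top (pairFam (τ l₀)) (pairFam-partition (τ l₀)) r) (λ r' _ → capture r')
    where
    all-leaves : ∀ t → IsLeaf E t
    all-leaves t with leaf? t
    ... | yes t-leaf = t-leaf
    ... | no int = ⊥-elim (no-internal (t , int))
    open NoInternalNode all-leaves l₀
    capture : ∀ r' X' → X' ∈ᶠ pairFam (τ l₀) → r' ∈ X' → 𝒮 X' ⊎ MonoWins 𝒫 𝒮 (pairFam (τ l₀)) r'
    capture r' X' X'∈ r'∈X' with to (∈pairFam⇔ (τ l₀) X') X'∈
    ... | inj₁ refl = inj₁ (τ𝒮 l₀ l₀-leaf)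
    ... | inj₂ refl with bag-cover r'
    ...   | l , l-leaf , r'∈l = inj₁ (subst 𝒮 (sym (complement-bag l-leaf r'∈l (x∈∁p⇒x∉p r'∈X'))) (τ𝒮 l l-leaf))

least-element : ∀ {k} (Z : Subset k) {x} → x ∈ Z → ∃[ y ] (y ∈ Z × (∀ z → z ∈ Z → y ≤ᶠ z))
least-element (inside ∷ Z) _ = zero , vhere , λ _ _ → z≤n
least-element (outside ∷ Z) (vthere x∈) with least-element Z x∈
... | y , y∈ , least = suc y , vthere y∈ , λ { (suc z) (vthere z∈) → s≤s (least z z∈) }

-- Decomposition trees, the inductive shadow of tree decompositions: a leaf is a
-- small set, and a node splits its set X into suc k parts (one of them empty)
-- so that the parts together with Xᶜ form a partition in 𝒫.
module StrategyTree {n : ℕ} {𝒫 : Family (suc n) → Set} {𝒮 : Subset (suc n) → Set}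
                    (sc : IsScenario 𝒫 𝒮) where
  open IsScenario sc

  k : ℕ
  k = suc n

  nodeFamily : Subset k → (Fin (suc k) → Subset k) → Family k
  nodeFamily X parts Z = ⌊ (Z ≟ˢ ∁ X) ⊎-dec any? (λ i → Z ≟ˢ parts i) ⌋

  ∈nodeFamily⇔ : ∀ X parts Z → Z ∈ᶠ nodeFamily X parts ⇔ (Z ≡ ∁ X ⊎ ∃[ i ] (Z ≡ parts i))
  ∈nodeFamily⇔ X parts Z = mk⇔ (does-true⇒ dec) (⇒does-true dec)
    where dec = (Z ≟ˢ ∁ X) ⊎-dec any? (λ i → Z ≟ˢ parts i)

  -- a node's parts are pairwise disjoint, cover X, and with Xᶜ form a partition in 𝒫;
  -- the empty part zero makes every node have at least two children
  record Split (X : Subset k) (parts : Fin (suc k) → Subset k) : Set where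
    field
      family∈𝒫    : 𝒫 (nodeFamily X parts)
      parts⊆      : ∀ i → parts i ⊆ X
      disjoint    : ∀ i j → i ≢ j → Disjoint (parts i) (parts j)
      cover       : ∀ x → x ∈ X → ∃[ i ] (x ∈ parts i)
      first-empty : parts zero ≡ ∅

  data DT : Subset k → Set where
    leaf : ∀ S → 𝒮 S → DT S
    node : ∀ {X} (parts : Fin (suc k) → Subset k) → Split X parts → (∀ i → DT (parts i)) → DT X

  small-set : ∀ {P r} → MonoWins 𝒫 𝒮 P r → ∃[ S ] (𝒮 S)
  small-set {r = r} (move P' P'∈𝒫 _ respond) with proj₂ (partitions P' P'∈𝒫) r
  ... | X' , X'∈ , r∈X' with respond r (λ _ _ _ r∈Z → r∈Z) X' X'∈ r∈X'
  ...   | inj₁ small = X' , small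
  ...   | inj₂ wins = small-set wins

  -- The empty set is small: it is a block of {∅, A}, coarser than {S, Sᶜ}.
  ∅∈𝒮 : ∀ S → 𝒮 S → 𝒮 ∅
  ∅∈𝒮 S S∈𝒮 = SC2 S ∅ (pairFam (∅ {k})) S∈𝒮 ⊥⊆
                 (SC1 (pairFam S) (pairFam ∅) (SC3 S S∈𝒮) (pairFam-partition (∅ {k})) coarser)
                 (from (∈pairFam⇔ (∅ {k}) ∅) (inj₁ refl))
    where
    coarser : Coarser (pairFam ∅) (pairFam S)
    coarser Z Z∈ x x∈Z with to (∈pairFam⇔ ∅ Z) Z∈
    ... | inj₁ refl = ⊥-elim (∉⊥ x∈Z)
    ... | inj₂ refl with x ∈? S
    ...   | yes x∈S = S , from (∈pairFam⇔ S S) (inj₁ refl) , x∈S , λ _ → x∉p⇒x∈∁p ∉⊥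
    ...   | no x∉S = ∁ S , from (∈pairFam⇔ S (∁ S)) (inj₂ refl) , x∉p⇒x∈∁p x∉S , λ _ → x∉p⇒x∈∁p ∉⊥

  -- The blocks of the captain's move P' inside the robber space X become the
  -- parts of a node; each block is indexed by (the successor of) its least element.
  module Blocks (P' : Family k) (P'∈𝒫 : 𝒫 P') (X : Subset k) (X-union : IsUnionOf P' X) where
    P'-part : IsPartition P'
    P'-part = partitions P' P'∈𝒫

    block : Fin k → Subset k
    block x = proj₁ (proj₂ P'-part x)

    block∈P' : ∀ x → block x ∈ᶠ P'
    block∈P' x = proj₁ (proj₂ (proj₂ P'-part x))

    ∈block : ∀ x → x ∈ block x
    ∈block x = proj₂ (proj₂ (proj₂ P'-part x))

    block-of-member : ∀ {x y} → y ∈ block x → block y ≡ block x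
    block-of-member {x} {y} y∈ = block-unique P'-part (block∈P' y) (block∈P' x) (∈block y) y∈

    block⊆X : ∀ {x} → x ∈ X → block x ⊆ X
    block⊆X {x} x∈X with X-union x x∈X
    ... | W , W∈ , x∈W , W⊆X = subst (_⊆ X) (block-unique P'-part W∈ (block∈P' x) x∈W (∈block x)) W⊆X

    Canonical : Fin k → Set
    Canonical x = x ∈ X × (∀ y → y ∈ block x → x ≤ᶠ y)

    canonical? : ∀ x → Dec (Canonical x)
    canonical? x = (x ∈? X) ×-dec all? (λ y → (y ∈? block x) →-dec (x FinP.≤? y))

    partOf : ∀ x → Dec (Canonical x) → Subset k
    partOf x (yes _) = block x
    partOf x (no _) = ∅

    part : Fin (suc k) → Subset k
    part zero = ∅
    part (suc x) = partOf x (canonical? x)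

    part-cases : ∀ i → part i ≡ ∅ ⊎ ∃[ x ] (i ≡ suc x × Canonical x × part i ≡ block x)
    part-cases zero = inj₁ refl
    part-cases (suc x) with canonical? x
    ... | yes c = inj₂ (x , refl , c , refl)
    ... | no _ = inj₁ refl

    canonical⇒part : ∀ {x} → Canonical x → part (suc x) ≡ block x
    canonical⇒part {x} c with canonical? x
    ... | yes _ = refl
    ... | no ¬c = ⊥-elim (¬c c)

    part⊆X : ∀ i → part i ⊆ X
    part⊆X i {y} y∈ with part-cases i
    ... | inj₁ e = ⊥-elim (∉⊥ (subst (y ∈_) e y∈))
    ... | inj₂ (x , _ , (x∈X , _) , e) = block⊆X x∈X (subst (y ∈_) e y∈)

    -- two canonical elements with the same block coincide
    parts-disjoint : ∀ i j → i ≢ j → Disjoint (part i) (part j)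
    parts-disjoint i j i≢j z z∈i z∈j with part-cases i | part-cases j
    ... | inj₁ e | _ = ∉⊥ (subst (z ∈_) e z∈i)
    ... | inj₂ _ | inj₁ e = ∉⊥ (subst (z ∈_) e z∈j)
    ... | inj₂ (x , refl , (_ , x-least) , ex) | inj₂ (y , refl , (_ , y-least) , ey) with block x ≟ˢ block y
    ...   | yes bx≡by = i≢j (cong suc (FinP.≤-antisym (x-least y (subst (y ∈_) (sym bx≡by) (∈block y)))
                                                      (y-least x (subst (x ∈_) bx≡by (∈block x)))))
    ...   | no bx≢by = proj₁ P'-part (block x) (block y) (block∈P' x) (block∈P' y) bx≢by z
                          (subst (z ∈_) ex z∈i) (subst (z ∈_) ey z∈j)

    parts-cover : ∀ x → x ∈ X → ∃[ i ] (x ∈ part i)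
    parts-cover x x∈X with least-element (block x) (∈block x)
    ... | y , y∈ , y-least = suc y , subst (x ∈_) (sym (trans (canonical⇒part y-canonical) (block-of-member y∈))) (∈block x)
      where
      y-canonical : Canonical y
      y-canonical = block⊆X x∈X y∈ , λ z z∈ → y-least z (subst (z ∈_) (block-of-member y∈) z∈)

    nodeFamily-partition : IsPartition (nodeFamily X part)
    nodeFamily-partition = disjoint , cover
      where
      disjoint : ∀ Z W → Z ∈ᶠ nodeFamily X part → W ∈ᶠ nodeFamily X part → Z ≢ W → Disjoint Z W
      disjoint Z W Z∈ W∈ Z≢W z z∈Z z∈W with to (∈nodeFamily⇔ X part Z) Z∈ | to (∈nodeFamily⇔ X part W) W∈
      ... | inj₁ refl | inj₁ refl = Z≢W refl
      ... | inj₁ refl | inj₂ (j , refl) = x∈∁p⇒x∉p z∈Z (part⊆X j z∈W)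
      ... | inj₂ (i , refl) | inj₁ refl = x∈∁p⇒x∉p z∈W (part⊆X i z∈Z)
      ... | inj₂ (i , refl) | inj₂ (j , refl) with i FinP.≟ j
      ...   | yes refl = Z≢W refl
      ...   | no i≢j = parts-disjoint i j i≢j z z∈Z z∈W
      cover : ∀ x → ∃[ Z ] (Z ∈ᶠ nodeFamily X part × x ∈ Z)
      cover x with x ∈? X
      ... | yes x∈X = let (i , x∈i) = parts-cover x x∈X in part i , from (∈nodeFamily⇔ X part _) (inj₂ (i , refl)) , x∈i
      ... | no x∉X = ∁ X , from (∈nodeFamily⇔ X part _) (inj₁ refl) , x∉p⇒x∈∁p x∉X

    -- Xᶜ is a union of blocks because X is; each part is a block or empty
    nodeFamily-coarser : Coarser (nodeFamily X part) P'
    nodeFamily-coarser Z Z∈ with to (∈nodeFamily⇔ X part Z) Z∈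
    ... | inj₁ refl = λ x x∉X → block x , block∈P' x , ∈block x ,
            λ {y} y∈ → x∉p⇒x∈∁p λ y∈X → x∈∁p⇒x∉p x∉X (block⊆X y∈X (subst (x ∈_) (sym (block-of-member y∈)) (∈block x)))
    ... | inj₂ (i , refl) with part-cases i
    ...   | inj₁ e = λ x x∈ → ⊥-elim (∉⊥ (subst (x ∈_) e x∈))
    ...   | inj₂ (y , _ , _ , e) = λ x x∈ → part i , subst (_∈ᶠ P') (sym e) (block∈P' y) , x∈ , λ z∈ → z∈

    split : Split X part
    split = record
      { family∈𝒫 = SC1 P' (nodeFamily X part) P'∈𝒫 nodeFamily-partition nodeFamily-coarser
      ; parts⊆ = part⊆X ; disjoint = parts-disjoint ; cover = parts-cover ; first-empty = refl }

    -- given subtrees for the blocks, the non-block parts become empty leaves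
    childTree : 𝒮 ∅ → (∀ x → Canonical x → DT (block x)) → ∀ i → DT (part i)
    childTree ∅-small sub zero = leaf ∅ ∅-small
    childTree ∅-small sub (suc x) = childOf (canonical? x)
      where
      childOf : (c? : Dec (Canonical x)) → DT (partOf x c?)
      childOf (yes c) = sub x c
      childOf (no _) = leaf ∅ ∅-small

  -- Unfolding a monotone winning strategy from the position (P, r) with robber
  -- space X: the captain's move P' splits X into blocks, and the robber may run
  -- to any point of X, i.e. into any of these blocks.
  unfold : 𝒮 ∅ → ∀ P → IsPartition P → ∀ r → MonoWins 𝒫 𝒮 P r → ∀ X → X ∈ᶠ P → r ∈ X → DT X
  unfold ∅-small P P-part r (move P' P'∈𝒫 monotone respond) X X∈ r∈X =
    node part split (childTree ∅-small subtree)
    where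
    open Blocks P' P'∈𝒫 X (monotone X X∈ r∈X)
    reachable : ∀ x → x ∈ X → InJoinBlock P P' r x
    reachable x x∈X Z Z-P Z-P' r∈Z with Z-P r r∈Z
    ... | W , W∈ , r∈W , W⊆Z = W⊆Z (subst (x ∈_) (block-unique P-part X∈ W∈ r∈X r∈W) x∈X)
    subtree : ∀ x → Canonical x → DT (block x)
    subtree x (x∈X , _) with respond x (reachable x x∈X) (block x) (block∈P' x) (∈block x)
    ... | inj₁ small = leaf (block x) small
    ... | inj₂ wins = unfold ∅-small P' P'-part x wins (block x) (block∈P' x) (∈block x)

module Positions {n : ℕ} {𝒫 : Family (suc n) → Set} {𝒮 : Subset (suc n) → Set}
                 (sc : IsScenario 𝒫 𝒮) where
  open StrategyTree sc

  -- a position is a path from the root of a decomposition tree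
  data Pos : ∀ {X} → DT X → Set where
    root : ∀ {X} {d : DT X} → Pos d
    down : ∀ {X parts s} {children : ∀ i → DT (parts i)} (i : Fin (suc k)) →
           Pos (children i) → Pos (node {X} parts s children)

  treeAt : ∀ {X} {d : DT X} → Pos d → Σ (Subset k) DT
  treeAt {X} {d} root = X , d
  treeAt (down i p) = treeAt p

  bag : ∀ {X} {d : DT X} → Pos d → Subset k
  bag p = proj₁ (treeAt p)

  data Terminal : ∀ {X} → DT X → Set where
    terminal : ∀ {S small} → Terminal (leaf S small)

  data Branching : ∀ {X} → DT X → Set where
    branching : ∀ {X parts s children} → Branching (node {X} parts s children)

  Final Inner : ∀ {X} {d : DT X} → Pos d → Set
  Final p = Terminal (proj₂ (treeAt p))
  Inner p = Branching (proj₂ (treeAt p))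

  final-or-inner : ∀ {X} {d : DT X} (p : Pos d) → Final p ⊎ Inner p
  final-or-inner p with proj₂ (treeAt p)
  ... | leaf _ _ = inj₁ terminal
  ... | node _ _ _ = inj₂ branching

  final⇒¬inner : ∀ {X} {d : DT X} (p : Pos d) → Final p → ¬ Inner p
  final⇒¬inner p fin inn with proj₂ (treeAt p)
  final⇒¬inner p terminal () | _

  final-small : ∀ {X} {d : DT X} (p : Pos d) → Final p → 𝒮 (bag p)
  final-small p fin with treeAt p
  final-small p terminal | S , leaf .S small = small

  down-injective : ∀ {X parts s children i} {p q : Pos (children i)} →
                   down {X} {parts} {s} {children} i p ≡ down i q → p ≡ q
  down-injective refl = refl

  down-index : ∀ {X parts s children i j} {p : Pos (children i)} {q : Pos (children j)} →
               down {X} {parts} {s} {children} i p ≡ down j q → i ≡ j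
  down-index refl = refl

  _≟ₚ_ : ∀ {X} {d : DT X} (p q : Pos d) → Dec (p ≡ q)
  root ≟ₚ root = yes refl
  root ≟ₚ down i q = no λ ()
  down i p ≟ₚ root = no λ ()
  down i p ≟ₚ down j q with i FinP.≟ j
  ... | no i≢j = no λ e → i≢j (down-index e)
  ... | yes refl with p ≟ₚ q
  ...   | yes refl = yes refl
  ...   | no p≢q = no λ e → p≢q (down-injective e)

  -- Parent p q: q is a child of p
  data Parent : ∀ {X} {d : DT X} → Pos d → Pos d → Set where
    at-root : ∀ {X parts s children} (i : Fin (suc k)) →
              Parent {d = node {X} parts s children} root (down i root)
    inside  : ∀ {X parts s children} (i : Fin (suc k)) {p q : Pos (children i)} →
              Parent p q → Parent {d = node {X} parts s children} (down i p) (down i q)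

  parent? : ∀ {X} {d : DT X} (p q : Pos d) → Dec (Parent p q)
  parent? root root = no λ ()
  parent? root (down i q) with q ≟ₚ root
  ... | yes refl = yes (at-root i)
  ... | no q≢root = no λ { (at-root _) → q≢root refl }
  parent? (down i p) root = no λ ()
  parent? (down i p) (down j q) with i FinP.≟ j
  ... | no i≢j = no λ { (inside _ _) → i≢j refl }
  ... | yes refl with parent? p q
  ...   | yes p→q = yes (inside i p→q)
  ...   | no ¬p→q = no λ { (inside _ p→q) → ¬p→q p→q }

  parent-inner : ∀ {X} {d : DT X} {p q : Pos d} → Parent p q → Inner p
  parent-inner (at-root i) = branching
  parent-inner (inside i p→q) = parent-inner p→q

  root-orphan : ∀ {X} {d : DT X} {p : Pos d} → ¬ Parent p root
  root-orphan ()

  parent-unique : ∀ {X} {d : DT X} {p p' q : Pos d} → Parent p q → Parent p' q → p ≡ p'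
  parent-unique (at-root i) (at-root .i) = refl
  parent-unique (at-root i) (inside .i p→q) = ⊥-elim (root-orphan p→q)
  parent-unique (inside i p→q) (at-root .i) = ⊥-elim (root-orphan p→q)
  parent-unique (inside i p→q) (inside .i p'→q) = cong (down i) (parent-unique p→q p'→q)

  parent-irreflexive : ∀ {X} {d : DT X} {p : Pos d} → ¬ Parent p p
  parent-irreflexive (inside i p→p) = parent-irreflexive p→p

  depth : ∀ {X} {d : DT X} → Pos d → ℕ
  depth root = 0
  depth (down i p) = suc (depth p)

  parent-depth : ∀ {X} {d : DT X} {p q : Pos d} → Parent p q → depth q ≡ suc (depth p)
  parent-depth (at-root i) = refl
  parent-depth (inside i p→q) = cong suc (parent-depth p→q)

  child : ∀ {X} {d : DT X} → Pos d → Fin (suc k) → Pos d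
  child {d = leaf _ _} root i = root
  child {d = node _ _ _} root i = down i root
  child (down j p) i = down j (child p i)

  parent-child : ∀ {X} {d : DT X} (p : Pos d) → Inner p → ∀ i → Parent p (child p i)
  parent-child {d = node _ _ _} root _ i = at-root i
  parent-child (down j p) inn i = inside j (parent-child p inn i)

  child-injective : ∀ {X} {d : DT X} (p : Pos d) → Inner p → ∀ i j → child p i ≡ child p j → i ≡ j
  child-injective {d = node _ _ _} root _ i j refl = refl
  child-injective (down l p) inn i j e = child-injective p inn i j (down-injective e)

  child≢root : ∀ {X} {d : DT X} (p : Pos d) → Inner p → ∀ i → child p i ≢ root
  child≢root p inn i e = root-orphan (subst (Parent p) e (parent-child p inn i))

  partsAt : ∀ {X} {d : DT X} (p : Pos d) → Inner p → Fin (suc k) → Subset k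
  partsAt {d = node parts _ _} root branching = parts
  partsAt (down i p) inn = partsAt p inn

  splitOf : ∀ {X} {d : DT X} (p : Pos d) (inn : Inner p) → Split (bag p) (partsAt p inn)
  splitOf {d = node _ s _} root branching = s
  splitOf (down i p) inn = splitOf p inn

  bag-child : ∀ {X} {d : DT X} (p : Pos d) (inn : Inner p) i → bag (child p i) ≡ partsAt p inn i
  bag-child {d = node _ _ _} root branching i = refl
  bag-child (down j p) inn i = bag-child p inn i

  -- Below p q: q lies in the subtree rooted at p
  data Below : ∀ {X} {d : DT X} → Pos d → Pos d → Set where
    from-root : ∀ {X} {d : DT X} {q : Pos d} → Below root q
    within    : ∀ {X parts s children i} {p q : Pos (children i)} →
                Below p q → Below {d = node {X} parts s children} (down i p) (down i q)

  below-refl : ∀ {X} {d : DT X} (p : Pos d) → Below p p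
  below-refl root = from-root
  below-refl (down i p) = within (below-refl p)

  below-root : ∀ {X} {d : DT X} {t : Pos d} → Below t root → t ≡ root
  below-root from-root = refl

  below? : ∀ {X} {d : DT X} (p q : Pos d) → Dec (Below p q)
  below? root q = yes from-root
  below? (down i p) root = no λ ()
  below? (down i p) (down j q) with i FinP.≟ j
  ... | no i≢j = no λ { (within _) → i≢j refl }
  ... | yes refl with below? p q
  ...   | yes p≤q = yes (within p≤q)
  ...   | no ¬p≤q = no λ { (within p≤q) → ¬p≤q p≤q }

  below-child⇒≢ : ∀ {X} {d : DT X} (t : Pos d) → Inner t → ∀ i {w} → Below (child t i) w → w ≢ t
  below-child⇒≢ {d = node _ _ _} root _ i () refl
  below-child⇒≢ (down j t) inn i (within below) refl = below-child⇒≢ t inn i below refl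

  below⇒below-child : ∀ {X} {d : DT X} {t u : Pos d} → Below t u → u ≢ t → Inner t →
                      ∃[ i ] (Below (child t i) u)
  below⇒below-child {u = root} from-root u≢t _ = ⊥-elim (u≢t refl)
  below⇒below-child {d = node _ _ _} {u = down i u} from-root _ _ = i , within from-root
  below⇒below-child (within below) u≢t inn with below⇒below-child below (λ e → u≢t (cong (down _) e)) inn
  ... | i , below' = i , within below'

  final-cover-root : ∀ {X} (d : DT X) x → x ∈ X → ∃[ l ] (Final {d = d} l × x ∈ bag l)
  final-cover-root (leaf S _) x x∈ = root , terminal , x∈
  final-cover-root (node parts s children) x x∈ with Split.cover s x x∈
  ... | i , x∈i with final-cover-root (children i) x x∈i
  ...   | l , fin , x∈l = down i l , fin , x∈l

  final⊆root : ∀ {X} (d : DT X) (l : Pos d) → Final l → bag l ⊆ X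
  final⊆root (leaf S _) root _ x∈ = x∈
  final⊆root (node parts s children) (down i l) fin x∈ = Split.parts⊆ s i (final⊆root (children i) l fin x∈)

  final-cover : ∀ {X} {d : DT X} (p : Pos d) x → x ∈ bag p → ∃[ l ] (Final l × Below p l × x ∈ bag l)
  final-cover {d = d} root x x∈ with final-cover-root d x x∈
  ... | l , fin , x∈l = l , fin , from-root , x∈l
  final-cover (down i p) x x∈ with final-cover p x x∈
  ... | l , fin , below , x∈l = down i l , fin , within below , x∈l

  final⊆ : ∀ {X} {d : DT X} (p l : Pos d) → Final l → Below p l → bag l ⊆ bag p
  final⊆ {d = d} root l fin _ = final⊆root d l fin
  final⊆ (down i p) (down .i l) fin (within below) = final⊆ p l fin below

  finals-disjoint : ∀ {X} {d : DT X} (l l' : Pos d) → Final l → Final l' → l ≢ l' → Disjoint (bag l) (bag l')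
  finals-disjoint {d = leaf _ _} root root _ _ l≢l' = ⊥-elim (l≢l' refl)
  finals-disjoint {d = node parts s children} (down i a) (down j b) fin fin' l≢l' x x∈a x∈b with i FinP.≟ j
  ... | yes refl = finals-disjoint a b fin fin' (λ e → l≢l' (cong (down i) e)) x x∈a x∈b
  ... | no i≢j = Split.disjoint s i j i≢j x (final⊆root (children i) a fin x∈a) (final⊆root (children j) b fin' x∈b)

  Adjacent : ∀ {X} {d : DT X} → Pos d → Pos d → Set
  Adjacent p q = Parent p q ⊎ Parent q p

  data PosWalk {X} {d : DT X} (ok : Pos d → Set) : Pos d → Pos d → Set where
    halt : ∀ {p} → ok p → PosWalk ok p p
    hop  : ∀ {p q r} → ok p → Adjacent p q → PosWalk ok q r → PosWalk ok p r

  module _ {X} {d : DT X} where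
    infixr 5 _++ᵖ_
    _++ᵖ_ : ∀ {ok} {p q r : Pos d} → PosWalk ok p q → PosWalk ok q r → PosWalk ok p r
    halt _ ++ᵖ w = w
    hop o a w ++ᵖ w' = hop o a (w ++ᵖ w')

    mapPosWalk : ∀ {ok ok' : Pos d → Set} → (∀ x → ok x → ok' x) → ∀ {p q} → PosWalk ok p q → PosWalk ok' p q
    mapPosWalk f (halt o) = halt (f _ o)
    mapPosWalk f (hop o a w) = hop (f _ o) a (mapPosWalk f w)

    posWalkStart : ∀ {ok} {p q : Pos d} → PosWalk ok p q → ok p
    posWalkStart (halt o) = o
    posWalkStart (hop o _ _) = o

    adjacent-sym : ∀ {p q : Pos d} → Adjacent p q → Adjacent q p
    adjacent-sym (inj₁ p→q) = inj₂ p→q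
    adjacent-sym (inj₂ q→p) = inj₁ q→p

    reversePosWalk : ∀ {ok} {p q : Pos d} → PosWalk ok p q → PosWalk ok q p
    reversePosWalk w = go w (halt (posWalkStart w))
      where
      go : ∀ {ok} {p q x : Pos d} → PosWalk ok p q → PosWalk ok p x → PosWalk ok q x
      go (halt o) acc = acc
      go (hop o a w) acc = go w (hop (posWalkStart w) (adjacent-sym a) acc)

  liftWalk : ∀ {X parts s children i} {ok : Pos (node {X} parts s children) → Set} {p q : Pos (children i)} →
             PosWalk (λ x → ok (down i x)) p q → PosWalk ok (down i p) (down i q)
  liftWalk (halt o) = halt o
  liftWalk (hop o a w) = hop o (lift a) (liftWalk w)
    where
    lift : ∀ {p q} → Adjacent p q → Adjacent (down _ p) (down _ q)
    lift (inj₁ p→q) = inj₁ (inside _ p→q)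
    lift (inj₂ q→p) = inj₂ (inside _ q→p)

  to-root : ∀ {X} {d : DT X} {ok : Pos d → Set} → (∀ w → ok w) → ∀ u → PosWalk ok u root
  to-root all-ok root = halt (all-ok root)
  to-root all-ok (down i u) = liftWalk (to-root (λ w → all-ok (down i w)) u)
                           ++ᵖ hop (all-ok _) (inj₂ (at-root i)) (halt (all-ok root))

  up-to : ∀ {X} {d : DT X} {ok : Pos d → Set} {c u : Pos d} → Below c u → (∀ w → Below c w → ok w) →
          PosWalk ok u c
  up-to {u = u} from-root ok-below = to-root (λ w → ok-below w from-root) u
  up-to (within below) ok-below = liftWalk (up-to below (λ w below' → ok-below (down _ w) (within below')))

  outside-to-root : ∀ {X} {d : DT X} (t u : Pos d) → ¬ Below t u → PosWalk (_≢ t) u root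
  outside-to-root t root ¬below = halt (λ e → ¬below (subst (λ z → Below z root) e from-root))
  outside-to-root root (down i u) ¬below = ⊥-elim (¬below from-root)
  outside-to-root (down j t) (down i u) ¬below with i FinP.≟ j
  ... | yes refl = liftWalk (mapPosWalk (λ w w≢t e → w≢t (down-injective e))
                                        (outside-to-root t u (λ below → ¬below (within below))))
                   ++ᵖ hop (λ e → ¬below (within (subst (λ z → Below z u) (down-injective e) from-root)))
                           (inj₂ (at-root i)) (halt λ ())
  ... | no i≢j = liftWalk (to-root {ok = λ w → down i w ≢ down j t} (λ w e → i≢j (down-index e)) u)
                 ++ᵖ hop (λ e → i≢j (down-index e)) (inj₂ (at-root i)) (halt λ ())

  below-child-step : ∀ {X} {d : DT X} (t : Pos d) → Inner t → ∀ i {u v} →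
                     Below (child t i) u → Adjacent u v → v ≢ t → Below (child t i) v
  below-child-step {d = node _ _ _} root _ i (within _) (inj₁ (inside _ _)) _ = within from-root
  below-child-step {d = node _ _ _} root _ i (within _) (inj₂ (at-root _)) v≢t = ⊥-elim (v≢t refl)
  below-child-step {d = node _ _ _} root _ i (within _) (inj₂ (inside _ _)) _ = within from-root
  below-child-step (down j t) inn i (within below) (inj₁ (inside _ u→v)) v≢t =
    within (below-child-step t inn i below (inj₁ u→v) (λ e → v≢t (cong (down j) e)))
  below-child-step (down j t) inn i (within below) (inj₂ (at-root _)) _ =
    ⊥-elim (child≢root t inn i (below-root below))
  below-child-step (down j t) inn i (within below) (inj₂ (inside _ v→u)) v≢t =
    within (below-child-step t inn i below (inj₂ v→u) (λ e → v≢t (cong (down j) e)))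

  below-step-back : ∀ {X} {d : DT X} (t : Pos d) {u v} → Below t v → Adjacent u v → v ≢ t → Below t u
  below-step-back root _ _ _ = from-root
  below-step-back (down j t) (within below) (inj₁ (at-root _)) v≢t = ⊥-elim (v≢t (cong (down j) (sym (below-root below))))
  below-step-back (down j t) (within below) (inj₁ (inside _ u→v)) v≢t =
    within (below-step-back t below (inj₁ u→v) (λ e → v≢t (cong (down j) e)))
  below-step-back (down j t) (within below) (inj₂ (inside _ v→u)) v≢t =
    within (below-step-back t below (inj₂ v→u) (λ e → v≢t (cong (down j) e)))

  walk-below-child : ∀ {X} {d : DT X} (t : Pos d) → Inner t → ∀ i {u v : Pos d} →
                     PosWalk (_≢ t) u v → Below (child t i) u → Below (child t i) v
  walk-below-child t inn i (halt _) below = below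
  walk-below-child t inn i (hop _ a w) below = walk-below-child t inn i w (below-child-step t inn i below a (posWalkStart w))

  walk-outside : ∀ {X} {d : DT X} (t : Pos d) {u v} → PosWalk (_≢ t) u v → ¬ Below t u → ¬ Below t v
  walk-outside t (halt _) ¬below = ¬below
  walk-outside t (hop _ a w) ¬below = walk-outside t w (λ below → ¬below (below-step-back t below a (posWalkStart w)))

  -- Along a walk that never turns straight back, a step down to a
  -- child can only be followed by further steps down (a position has a single
  -- parent); so such a walk that starts downwards ends deeper, and one that
  -- ends upwards ends higher.  A cycle is such a walk returning to its start.
  module Acyclicity {X} {d : DT X} where

    NoBacktrack : List (Pos d) → Set
    NoBacktrack (a ∷ b ∷ c ∷ r) = a ≢ c × NoBacktrack (b ∷ c ∷ r)
    NoBacktrack _ = Unit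

    lastOf : Pos d → List (Pos d) → Pos d
    lastOf b [] = b
    lastOf b (c ∷ cs) = lastOf c cs

    lastOf-snoc : ∀ b xs z → lastOf b (xs ∷ʳ z) ≡ z
    lastOf-snoc b [] z = refl
    lastOf-snoc b (c ∷ cs) z = lastOf-snoc c cs z

    lastOf∈ : ∀ b xs → lastOf b xs ∈ₗ (b ∷ xs)
    lastOf∈ b [] = here refl
    lastOf∈ b (c ∷ cs) = there (lastOf∈ c cs)

    deeper : ∀ {a b : Pos d} → Parent a b → depth a < depth b
    deeper {a} a→b = subst (depth a <_) (sym (parent-depth a→b)) (ℕP.n<1+n (depth a))

    starts-down⇒deeper : ∀ xs a b → NoBacktrack (a ∷ b ∷ xs) → Linked Adjacent (a ∷ b ∷ xs) →
                         Parent a b → depth a < depth (lastOf b xs)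
    starts-down⇒deeper [] a b _ _ a→b = deeper a→b
    starts-down⇒deeper (c ∷ cs) a b (a≢c , nb) (_ ∷ (inj₁ b→c ∷ l)) a→b =
      ℕP.<-trans (deeper a→b) (starts-down⇒deeper cs b c nb (inj₁ b→c ∷ l) b→c)
    starts-down⇒deeper (c ∷ cs) a b (a≢c , _) (_ ∷ (inj₂ c→b ∷ _)) a→b = ⊥-elim (a≢c (parent-unique a→b c→b))

    EndsUp EndsDown : Pos d → Pos d → List (Pos d) → Set
    EndsUp a b [] = Parent b a
    EndsUp a b (c ∷ cs) = EndsUp b c cs
    EndsDown a b [] = Parent a b
    EndsDown a b (c ∷ cs) = EndsDown b c cs

    ends-up-or-down : ∀ xs a b → Linked Adjacent (a ∷ b ∷ xs) → EndsUp a b xs ⊎ EndsDown a b xs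
    ends-up-or-down [] a b (inj₁ a→b ∷ _) = inj₂ a→b
    ends-up-or-down [] a b (inj₂ b→a ∷ _) = inj₁ b→a
    ends-up-or-down (c ∷ cs) a b (_ ∷ l) = ends-up-or-down cs b c l

    ends-down-parent : ∀ a b xs z → EndsDown a b (xs ∷ʳ z) → Parent (lastOf b xs) z
    ends-down-parent a b [] z last-down = last-down
    ends-down-parent a b (c ∷ cs) z last-down = ends-down-parent b c cs z last-down

    ends-up⇒higher : ∀ xs a b → NoBacktrack (a ∷ b ∷ xs) → Linked Adjacent (a ∷ b ∷ xs) →
                     EndsUp a b xs → depth (lastOf b xs) < depth a
    ends-up⇒higher [] a b _ _ b→a = deeper b→a
    ends-up⇒higher (c ∷ cs) a b (a≢c , nb) (first ∷ l) up with ends-up⇒higher cs b c nb l up | first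
    ... | higher | inj₂ b→a = ℕP.<-trans higher (deeper b→a)
    ... | higher | inj₁ a→b = ⊥-elim (ℕP.<⇒≱ (starts-down⇒deeper (c ∷ cs) a b (a≢c , nb) (first ∷ l) a→b)
                                              (ℕP.≤-pred (subst (depth (lastOf c cs) <_) (parent-depth a→b) higher)))

    cycle-no-backtrack : ∀ b xs z → Unique (b ∷ xs) → ¬ (z ∈ₗ (b ∷ xs)) → NoBacktrack (b ∷ (xs ∷ʳ z))
    cycle-no-backtrack b [] z _ _ = tt
    cycle-no-backtrack b (c ∷ []) z _ z∉ = (λ e → z∉ (here (sym e))) , tt
    cycle-no-backtrack b (c ∷ e ∷ es) z ((_ ∷ b≢e ∷ _) ∷ u) z∉ = b≢e , cycle-no-backtrack c (e ∷ es) z u (λ z∈ → z∉ (there z∈))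

    no-cycle : ∀ (v : Pos d) vs → ¬ (Unique (v ∷ vs) × 2 ≤ length vs × Linked Adjacent ((v ∷ vs) ∷ʳ v))
    no-cycle v [] (_ , () , _)
    no-cycle v (_ ∷ []) (_ , s≤s () , _)
    no-cycle v (x ∷ y ∷ rest) ((v∉ ∷ uvs@(x∉ ∷ _)) , _ , closed@(first ∷ _)) = by-first-step first
      where
      cycle-nb : NoBacktrack (v ∷ x ∷ ((y ∷ rest) ∷ʳ v))
      cycle-nb = (λ v≡y → All¬⇒¬Any v∉ (there (here v≡y))) , cycle-no-backtrack x (y ∷ rest) v uvs (All¬⇒¬Any v∉)
      returns : lastOf x ((y ∷ rest) ∷ʳ v) ≡ v
      returns = lastOf-snoc x (y ∷ rest) v
      by-first-step : Adjacent v x → ⊥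
      by-first-step (inj₁ v→x) =
        ℕP.<-irrefl refl (subst (λ z → depth v < depth z) returns (starts-down⇒deeper _ v x cycle-nb closed v→x))
      by-first-step (inj₂ x→v) with ends-up-or-down ((y ∷ rest) ∷ʳ v) v x closed
      ... | inj₁ up = ℕP.<-irrefl refl (subst (λ z → depth z < depth v) returns (ends-up⇒higher _ v x cycle-nb closed up))
      ... | inj₂ last-down = All¬⇒¬Any x∉ (subst (_∈ₗ (y ∷ rest)) (sym (parent-unique x→v (ends-down-parent v x (y ∷ rest) v last-down)))
                                           (lastOf∈ y rest))

-- Fin (s 0 + s 1 + ⋯) enumerates the pairs (i , x) with x : Fin (s i).
total : ∀ {j} → (Fin j → ℕ) → ℕ
total {zero} s = 0
total {suc j} s = s zero + total (s ∘ suc)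

inject : ∀ {j} (s : Fin j → ℕ) (i : Fin j) → Fin (s i) → Fin (total s)
inject s zero x = x ↑ˡ total (s ∘ suc)
inject s (suc i) x = s zero ↑ʳ inject (s ∘ suc) i x

project : ∀ {j} (s : Fin j → ℕ) → Fin (total s) → Σ (Fin j) (Fin ∘ s)
project-split : ∀ {j} (s : Fin (suc j) → ℕ) → Fin (s zero) ⊎ Fin (total (s ∘ suc)) → Σ (Fin (suc j)) (Fin ∘ s)

project {suc j} s w = project-split s (splitAt (s zero) w)
project-split s (inj₁ x) = zero , x
project-split s (inj₂ y) = suc (proj₁ (project (s ∘ suc) y)) , proj₂ (project (s ∘ suc) y)

project-inject : ∀ {j} (s : Fin j → ℕ) i x → project s (inject s i x) ≡ (i , x)
project-inject s zero x rewrite FinP.splitAt-↑ˡ (s zero) x (total (s ∘ suc)) = refl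
project-inject s (suc i) x rewrite FinP.splitAt-↑ʳ (s zero) (total (s ∘ suc)) (inject (s ∘ suc) i x)
                                 | project-inject (s ∘ suc) i x = refl

inject-project : ∀ {j} (s : Fin j → ℕ) w → inject s (proj₁ (project s w)) (proj₂ (project s w)) ≡ w
inject-project {suc j} s w = trans (split-cases (splitAt (s zero) w)) (FinP.join-splitAt (s zero) _ w)
  where
  split-cases : ∀ v → inject s (proj₁ (project-split s v)) (proj₂ (project-split s v)) ≡ join (s zero) _ v
  split-cases (inj₁ x) = refl
  split-cases (inj₂ y) = cong (s zero ↑ʳ_) (inject-project (s ∘ suc) y)

module Enumeration {n : ℕ} {𝒫 : Family (suc n) → Set} {𝒮 : Subset (suc n) → Set}
                   (sc : IsScenario 𝒫 𝒮) where
  open StrategyTree sc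
  open Positions sc

  size : ∀ {X} → DT X → ℕ
  size (leaf _ _) = 1
  size (node _ _ children) = suc (total (size ∘ children))

  size-positive : ∀ {X} (d : DT X) → 1 ≤ size d
  size-positive (leaf _ _) = s≤s z≤n
  size-positive (node _ _ _) = s≤s z≤n

  -- positions numbered in preorder: the root first, then each child's block in turn
  decode : ∀ {X} (d : DT X) → Fin (size d) → Pos d
  decode (leaf _ _) zero = root
  decode (node _ _ children) zero = root
  decode (node _ _ children) (suc w) with project (size ∘ children) w
  ... | i , x = down i (decode (children i) x)

  encode : ∀ {X} {d : DT X} → Pos d → Fin (size d)
  encode {d = leaf _ _} root = zero
  encode {d = node _ _ _} root = zero
  encode {d = node _ _ children} (down i p) = suc (inject (size ∘ children) i (encode p))

  decode-encode : ∀ {X} {d : DT X} (p : Pos d) → decode d (encode p) ≡ p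
  decode-encode {d = leaf _ _} root = refl
  decode-encode {d = node _ _ _} root = refl
  decode-encode {d = node _ _ children} (down i p)
    rewrite project-inject (size ∘ children) i (encode p) = cong (down i) (decode-encode p)

  encode-decode : ∀ {X} (d : DT X) (w : Fin (size d)) → encode (decode d w) ≡ w
  encode-decode (leaf _ _) zero = refl
  encode-decode (node _ _ children) zero = refl
  encode-decode (node _ _ children) (suc w) =
    cong suc (trans (decoded (project (size ∘ children) w)) (inject-project (size ∘ children) w))
    where
    decoded : ∀ ix → inject (size ∘ children) (proj₁ ix) (encode (decode (children (proj₁ ix)) (proj₂ ix)))
                   ≡ inject (size ∘ children) (proj₁ ix) (proj₂ ix)
    decoded (i , x) = cong (inject (size ∘ children) i) (encode-decode (children i) x)

-- the root of a decomposition tree of A has no outside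
∁⊤≡∅ : ∀ {k} → ∁ (⊤ {k}) ≡ ∅
∁⊤≡∅ = Empty-unique λ (x , x∈) → x∈∁p⇒x∉p x∈ ∈⊤

-- A decomposition tree of A yields a tree decomposition: its positions form the
-- tree, leaf positions carry their small sets, and the components of T - p at
-- an inner position p are the subtrees of the children of p (whose leaves
-- carry the parts of p) together with the rest of the tree (whose leaves carry
-- the complement of the set at p).
module Decomposition {n : ℕ} {𝒫 : Family (suc n) → Set} {𝒮 : Subset (suc n) → Set}
                     (sc : IsScenario 𝒫 𝒮) (d₀ : StrategyTree.DT sc ⊤) where
  open StrategyTree sc
  open Positions sc
  open Enumeration sc

  Node : Set
  Node = Pos d₀

  Side : Node → Node → Fin k → Set
  Side p u x = ∃[ q ] (Final q × PosWalk (_≢ p) u q × x ∈ bag q)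

  side-below-child : ∀ p (inn : Inner p) i u → Below (child p i) u → ∀ x → Side p u x ⇔ x ∈ bag (child p i)
  side-below-child p inn i u below x = mk⇔
    (λ (q , fin , u⋯q , x∈) → final⊆ (child p i) q fin (walk-below-child p inn i u⋯q below) x∈)
    (λ x∈ → let (q , fin , below-q , x∈q) = final-cover (child p i) x x∈ in
      q , fin , up-to below avoid ++ᵖ reversePosWalk (up-to below-q avoid) , x∈q)
    where
    avoid : ∀ w → Below (child p i) w → w ≢ p
    avoid w = below-child⇒≢ p inn i

  side-outside : ∀ p u → ¬ Below p u → ∀ x → Side p u x ⇔ x ∈ ∁ (bag p)
  side-outside p u ¬below x = mk⇔ side⇒complement complement⇒side
    where
    side⇒complement : Side p u x → x ∈ ∁ (bag p)
    side⇒complement (q , fin , u⋯q , x∈q) = x∉p⇒x∈∁p λ x∈p →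
      let (q' , fin' , below' , x∈q') = final-cover p x x∈p
      in finals-disjoint q q' fin fin' (λ { refl → walk-outside p u⋯q ¬below below' }) x x∈q x∈q'
    complement⇒side : x ∈ ∁ (bag p) → Side p u x
    complement⇒side x∉ with final-cover-root d₀ x ∈⊤
    ... | q , fin , x∈q with below? p q
    ...   | yes below-q = ⊥-elim (x∈∁p⇒x∉p x∉ (final⊆ p q fin below-q x∈q))
    ...   | no ¬below-q = q , fin , outside-to-root p u ¬below ++ᵖ reversePosWalk (outside-to-root p q ¬below-q) , x∈q


  component-sets : ∀ p (inn : Inner p) Z →
    (Z ≡ ∁ (bag p) ⊎ ∃[ i ] (Z ≡ partsAt p inn i)) ⇔ (∃[ u ] (u ≢ p × (∀ x → x ∈ Z ⇔ Side p u x)))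
  component-sets p inn Z = mk⇔ component set
    where
    child-component : ∀ i → Z ≡ partsAt p inn i → ∃[ u ] (u ≢ p × (∀ x → x ∈ Z ⇔ Side p u x))
    child-component i refl = child p i , (λ e → parent-irreflexive (subst (Parent p) e (parent-child p inn i))) ,
      λ x → subst (λ W → x ∈ W ⇔ Side p (child p i) x) (bag-child p inn i)
                  (⇔-sym (side-below-child p inn i (child p i) (below-refl _) x))
    component : (Z ≡ ∁ (bag p) ⊎ ∃[ i ] (Z ≡ partsAt p inn i)) → ∃[ u ] (u ≢ p × (∀ x → x ∈ Z ⇔ Side p u x))
    component (inj₂ (i , Z≡part)) = child-component i Z≡part
    component (inj₁ refl) with p ≟ₚ root
    ... | yes refl = child-component zero (trans ∁⊤≡∅ (sym (Split.first-empty (splitOf root inn))))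
    ... | no p≢root = root , (λ e → p≢root (sym e)) ,
      λ x → ⇔-sym (side-outside p root (λ below → p≢root (below-root below)) x)
    set : ∃[ u ] (u ≢ p × (∀ x → x ∈ Z ⇔ Side p u x)) → Z ≡ ∁ (bag p) ⊎ ∃[ i ] (Z ≡ partsAt p inn i)
    set (u , u≢p , Z≈side) with below? p u
    ... | yes below with below⇒below-child below u≢p inn
    ...   | i , below-child = inj₂ (i , subset-ext λ x →
            ⇔-trans (Z≈side x) (subst (λ W → Side p u x ⇔ x ∈ W) (bag-child p inn i) (side-below-child p inn i u below-child x)))
    set (u , u≢p , Z≈side) | no ¬below = inj₁ (subset-ext λ x → ⇔-trans (Z≈side x) (side-outside p u ¬below x))

  m₀ : ℕ
  m₀ = size d₀

  pos : Fin m₀ → Node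
  pos = decode d₀

  adjacent? : ∀ (p q : Node) → Dec (Adjacent p q)
  adjacent? p q = parent? p q ⊎-dec parent? q p

  E₀ : Fin m₀ → Fin m₀ → Bool
  E₀ u v = ⌊ adjacent? (pos u) (pos v) ⌋

  E₀⇔ : ∀ {u v} → Adj E₀ u v ⇔ Adjacent (pos u) (pos v)
  E₀⇔ {u} {v} = mk⇔ (does-true⇒ (adjacent? (pos u) (pos v))) (⇒does-true (adjacent? (pos u) (pos v)))

  pos-injective : ∀ {u v} → pos u ≡ pos v → u ≡ v
  pos-injective {u} {v} e = trans (sym (encode-decode d₀ u)) (trans (cong encode e) (encode-decode d₀ v))

  adjacent⇒E₀ : ∀ {p q} → Adjacent p q → Adj E₀ (encode p) (encode q)
  adjacent⇒E₀ {p} {q} a = from E₀⇔ (subst₂ Adjacent (sym (decode-encode p)) (sym (decode-encode q)) a)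

  toPosWalk : ∀ {ok : Node → Set} {u v} → Walk E₀ (ok ∘ pos) u v → PosWalk ok (pos u) (pos v)
  toPosWalk (here o) = halt o
  toPosWalk (step o a w) = hop o (to E₀⇔ a) (toPosWalk w)

  fromPosWalk : ∀ {ok : Node → Set} {p q} → PosWalk ok p q → Walk E₀ (ok ∘ pos) (encode p) (encode q)
  fromPosWalk {ok} {p} (halt o) = here (subst ok (sym (decode-encode p)) o)
  fromPosWalk {ok} {p} (hop o a w) = step (subst ok (sym (decode-encode p)) o) (adjacent⇒E₀ a) (fromPosWalk w)

  fromPosWalkAt : ∀ {ok : Node → Set} {u v} → PosWalk ok (pos u) (pos v) → Walk E₀ (ok ∘ pos) u v
  fromPosWalkAt {ok} {u} {v} w = subst₂ (Walk E₀ (ok ∘ pos)) (encode-decode d₀ u) (encode-decode d₀ v) (fromPosWalk w)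

  E₀-symmetric : ∀ u v → E₀ u v ≡ E₀ v u
  E₀-symmetric u v = trans (isYes≗does (adjacent? (pos u) (pos v)))
                       (trans (does-⇔ (mk⇔ (adjacent-sym {p = pos u}) (adjacent-sym {p = pos v}))
                                      (adjacent? (pos u) (pos v)) (adjacent? (pos v) (pos u)))
                              (sym (isYes≗does (adjacent? (pos v) (pos u)))))

  E₀-irreflexive : ∀ u → E₀ u u ≡ false
  E₀-irreflexive u = trans (isYes≗does (adjacent? (pos u) (pos u))) (dec-false (adjacent? (pos u) (pos u)) not-self)
    where
    not-self : ¬ Adjacent (pos u) (pos u)
    not-self (inj₁ p→p) = parent-irreflexive p→p
    not-self (inj₂ p→p) = parent-irreflexive p→p

  open Walks E₀

  tree : Tree
  tree = record
    { m = m₀ ; E = E₀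
    ; symmetric = E₀-symmetric
    ; irreflex = E₀-irreflexive
    ; nonempty = size-positive d₀
    ; connected = λ u v → fromPosWalkAt (to-root (λ _ → _) (pos u) ++ᵖ reversePosWalk (to-root (λ _ → _) (pos v)))
    ; acyclic = λ v vs (unique , long , closed) → Acyclicity.no-cycle (pos v) (map pos vs)
        ( Uniqueₚ.map⁺ pos-injective unique
        , subst (2 ≤_) (sym (length-map pos vs)) long
        , subst (Linked Adjacent) (map-++ pos (v ∷ vs) (v ∷ [])) (Linkedₚ.map⁺ (Linked.map (to E₀⇔) closed)) ) }

  encode-injective : ∀ {p q : Node} → encode p ≡ encode q → p ≡ q
  encode-injective {p} {q} e = trans (sym (decode-encode p)) (trans (cong pos e) (decode-encode q))

  inner⇒¬leaf : ∀ u → Inner (pos u) → ¬ IsLeaf E₀ u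
  inner⇒¬leaf u inn u-leaf =
    FinP.0≢1+n (child-injective (pos u) inn zero (suc zero)
                 (encode-injective (to (leaf⇔ E₀ u) u-leaf (to-child zero) (to-child (suc zero)))))
    where
    to-child : ∀ i → Adj E₀ u (encode (child (pos u) i))
    to-child i = from E₀⇔ (subst (Adjacent (pos u)) (sym (decode-encode _)) (inj₁ (parent-child (pos u) inn i)))

  final⇒leaf : ∀ u → Final (pos u) → IsLeaf E₀ u
  final⇒leaf u fin = from (leaf⇔ E₀ u) λ u~a u~b → pos-injective (parent-unique (up u~a) (up u~b))
    where
    up : ∀ {a} → Adj E₀ u a → Parent (pos a) (pos u)
    up u~a with to E₀⇔ u~a
    ... | inj₁ u→a = ⊥-elim (final⇒¬inner (pos u) fin (parent-inner u→a))
    ... | inj₂ a→u = a→u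

  leaf⇒final : ∀ u → IsLeaf E₀ u → Final (pos u)
  leaf⇒final u u-leaf with final-or-inner (pos u)
  ... | inj₁ fin = fin
  ... | inj₂ inn = ⊥-elim (inner⇒¬leaf u inn u-leaf)

  final⇒leaf-at-encoding : ∀ q → Final q → IsLeaf E₀ (encode q)
  final⇒leaf-at-encoding q fin = final⇒leaf (encode q) (subst Final (sym (decode-encode q)) fin)

  τ₀ : Fin m₀ → Subset k
  τ₀ u = bag (pos u)

  leaf-sets-partition : IsPartitionPred (λ Z → ∃[ l ] (IsLeaf E₀ l × τ₀ l ≡ Z))
  leaf-sets-partition = disjoint , cover
    where
    disjoint : ∀ Z W → (∃[ l ] (IsLeaf E₀ l × τ₀ l ≡ Z)) → (∃[ l ] (IsLeaf E₀ l × τ₀ l ≡ W)) → Z ≢ W → Disjoint Z W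
    disjoint Z W (l , l-leaf , refl) (l' , l'-leaf , refl) Z≢W =
      finals-disjoint (pos l) (pos l') (leaf⇒final l l-leaf) (leaf⇒final l' l'-leaf) (λ e → Z≢W (cong bag e))
    cover : ∀ x → ∃[ Z ] ((∃[ l ] (IsLeaf E₀ l × τ₀ l ≡ Z)) × x ∈ Z)
    cover x with final-cover-root d₀ x ∈⊤
    ... | q , fin , x∈q = bag q , (encode q , final⇒leaf-at-encoding q fin , cong bag (decode-encode q)) , x∈q

  LeafSide : Fin m₀ → Fin m₀ → Fin k → Set
  LeafSide t u x = ∃[ l ] (IsLeaf E₀ l × Walk E₀ (λ w → w ≢ t) u l × x ∈ τ₀ l)

  leafSide⇔side : ∀ t u x → LeafSide t u x ⇔ Side (pos t) (pos u) x
  leafSide⇔side t u x = mk⇔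
    (λ (l , l-leaf , u⋯l , x∈) → pos l , leaf⇒final l l-leaf ,
       toPosWalk (mapWalk (λ v v≢t e → v≢t (pos-injective e)) u⋯l) , x∈)
    (λ (q , fin , u⋯q , x∈) → encode q , final⇒leaf-at-encoding q fin ,
       mapWalk (λ v v≢t e → v≢t (cong pos e)) (fromPosWalkAt (subst (PosWalk _ (pos u)) (sym (decode-encode q)) u⋯q)) ,
       subst (x ∈_) (cong bag (sym (decode-encode q))) x∈)

  components⇔ : ∀ t Z → (∃[ u ] (u ≢ pos t × (∀ x → x ∈ Z ⇔ Side (pos t) u x)))
                      ⇔ (∃[ u ] (u ≢ t × (∀ x → x ∈ Z ⇔ LeafSide t u x)))
  components⇔ t Z = mk⇔
    (λ (u , u≢ , Z≈side) → encode u , (λ e → u≢ (trans (sym (decode-encode u)) (cong pos e))) ,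
       λ x → ⇔-trans (Z≈side x) (⇔-sym (subst (λ v → LeafSide t (encode u) x ⇔ Side (pos t) v x)
                                                (decode-encode u) (leafSide⇔side t (encode u) x))))
    (λ (u , u≢t , Z≈side) → pos u , (λ e → u≢t (pos-injective e)) , λ x → ⇔-trans (Z≈side x) (leafSide⇔side t u x))

  node-partition : ∀ t → ¬ IsLeaf E₀ t →
                   ∃[ Pₜ ] ((∀ Z → (Z ∈ᶠ Pₜ) ⇔ (∃[ u ] (u ≢ t × (∀ x → x ∈ Z ⇔ LeafSide t u x)))) × 𝒫 Pₜ)
  node-partition t t-internal with final-or-inner (pos t)
  ... | inj₁ fin = ⊥-elim (t-internal (final⇒leaf t fin))
  ... | inj₂ inn = nodeFamily (bag (pos t)) (partsAt (pos t) inn) ,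
    (λ Z → ⇔-trans (∈nodeFamily⇔ _ _ Z) (⇔-trans (component-sets (pos t) inn Z) (components⇔ t Z))) ,
    Split.family∈𝒫 (splitOf (pos t) inn)

  treeDecomposition : TreeDecomposition 𝒫 𝒮
  treeDecomposition = record
    { T = tree ; τ = τ₀
    ; τ𝒮 = λ l l-leaf → final-small (pos l) (leaf⇒final l l-leaf)
    ; TD1 = leaf-sets-partition
    ; TD2 = node-partition }

strategy⇒decomposition : ∀ {n} {𝒫 : Family (suc n) → Set} {𝒮 : Subset (suc n) → Set} →
                         IsScenario 𝒫 𝒮 → CaptainWinsMonotone 𝒫 𝒮 → TreeDecomposition 𝒫 𝒮
strategy⇒decomposition {𝒮 = 𝒮} sc (_ , wins) = Decomposition.treeDecomposition sc tree-of-A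
  where
  open StrategyTree sc
  ∅-small : 𝒮 ∅
  ∅-small = ∅∈𝒮 (proj₁ (small-set (wins zero))) (proj₂ (small-set (wins zero)))
  tree-of-A : DT ⊤
  tree-of-A = unfold ∅-small trivialFam trivialFam-partition zero (wins zero) ⊤ (from (∈trivialFam⇔ ⊤) refl) ∈⊤

theorem1 : (n : ℕ) (𝒫 : Family (suc n) → Set) (𝒮 : Subset (suc n) → Set) →
           IsScenario 𝒫 𝒮 →
           (TreeDecomposition 𝒫 𝒮 ⇔ CaptainWinsMonotone 𝒫 𝒮)
theorem1 n 𝒫 𝒮 sc = mk⇔ (DecompositionStrategy.captain-wins sc) (strategy⇒decomposition sc)
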